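{- Let $q$ be a prime power and $n,m,k$ integers with $1<k<n\le m$. There exists an FWS $[n,k]_{q^m/q}$ code if and only if $n<2^k$. Moreover, in this case, for every $\lambda\in\mathbb{F}_{q^m}$ with $\mathbb{F}_q(\lambda)=\mathbb{F}_{q^m}$, the code $\mathcal C_{\lambda,\mathbf n}$ defined below is an FWS code: let $S=\{i\in\mathbb{Z}_{\ge0}:(n-i)/2^{k-i-1}\ge1\}$, $z=\min S$; if $z=0$ let $\mathbf n=\Psi(n,k)$; if $z>0$ let $(n_1,\dots,n_{k-z})=\Psi(n-z,k-z)$ and $\mathbf n=(n_1,\dots,n_{k-z},1,\dots,1)$ with $z$ trailing ones.
   Context: $\mathbb{F}_{q^m}$ is the degree-$m$ extension of $\mathbb{F}_q$. Rank weight of $\mathbf v=(v_1,\dots,v_n)\in\mathbb{F}_{q^m}^n$: $\mathrm{w}(\mathbf v)=\dim_{\mathbb{F}_q}\langle v_1,\dots,v_n\rangle_{\mathbb{F}_q}$. An $[n,k]_{q^m/q}$ code is a $k$-dimensional $\mathbb{F}_{q^m}$-subspace $\mathcal C\subseteq\mathbb{F}_{q^m}^n$, with weight spectrum $\mathrm{WS}(\mathcal C)=\{\mathrm{w}(\mathbf c):\mathbf c\in\mathcal C\setminus\{\mathbf 0\}\}$. It is FWS (full weight spectrum) if $\mathrm{WS}(\mathcal C)=\{1,2,\dots,\min\{m,n\}\}$. For integers $u\ge v\ge 2$, $\Psi(u,v):=(u_1,\dots,u_v)$ with $u_1=\lceil u/2\rceil$, $u_i=\lceil\lfloor u/2^{i-1}\rfloor/2\rceil$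 for $2\le i\le v-1$, $u_v=\lfloor u/2^{v-1}\rfloor$. $\mathbf u_{\lambda,\ell}=(1,\lambda,\dots,\lambda^{\ell-1})$. For $\mathbf n=(n_1,\dots,n_k)$ with $m\ge n_1\ge\dots\ge n_k\ge 1$, $\mathcal C_{\lambda,\mathbf n}$ is the code in $\mathbb{F}_{q^m}^{n_1+\dots+n_k}$ generated by the block-diagonal matrix whose $i$-th row is $\mathbf u_{\lambda,n_i}$ on the $i$-th block of $n_i$ consecutive coordinates and $0$ elsewhere. -}

module Defs where

open import Level using (Level; _⊔_) renaming (suc to lsuc)
open import Algebra.Bundles using (CommutativeRing)
open import Data.Nat as ℕ using (ℕ; zero; suc; _∸_; _^_; _<_; _≤_; _⊓_)
open import Data.Nat.DivMod using (_/_)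
open import Data.Nat.Properties using (m^n≢0)
open import Data.Nat.Primality using (Prime)
open import Data.Fin as Fin using (Fin; toℕ; splitAt)
open import Data.Vec using (Vec; tabulate; lookup)
open import Data.Sum using (_⊎_; inj₁; inj₂)
open import Data.Product using (Σ; ∃; ∃-syntax; _×_; _,_)
open import Relation.Nullary using (¬_; does)
open import Relation.Binary.PropositionalEquality using (_≡_)
open import Data.Bool using (if_then_else_)
open import Function.Bundles using (_⇔_)

IsPrimePower : ℕ → Set
IsPrimePower q = ∃[ p ] ∃[ e ] (Prime p × 1 ≤ e × q ≡ p ^ e)

-- i-th (0-based) entry of Ψ(u,v):
--   entries 0..v-2 : ⌈ ⌊u/2^i⌋ / 2 ⌉   (for i = 0 this is ⌈u/2⌉)
--   entry  v-1     : ⌊u/2^(v-1)⌋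
psi : ℕ → ℕ → ℕ → ℕ
psi u v i = if does (suc i ℕ.≟ v) then _/_ u (2 ^ (v ∸ 1)) {{m^n≢0 2 (v ∸ 1)}} else (_/_ u (2 ^ i) {{m^n≢0 2 i}} ℕ.+ 1) / 2

Ψ : ℕ → (v : ℕ) → Vec ℕ v
Ψ u v = tabulate (λ i → psi u v (toℕ i))

-- membership of i ∈ ℤ≥0 in S = { i : (n - i)/2^(k-i-1) ≥ 1 } (rational arithmetic):
--   for i < k :  2^(k-i-1) ≤ n - i
--   for i ≥ k :  (n - i)·2^(i-k+1) ≥ 1, i.e. i < n
InS : ℕ → ℕ → ℕ → Set
InS n k i = (i < k × 2 ^ (k ∸ suc i) ℕ.+ i ≤ n) ⊎ (k ≤ i × i < n)

IsMinS : ℕ → ℕ → ℕ → Set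
IsMinS n k z = InS n k z × (∀ i → i < z → ¬ InS n k i)

nVec : ℕ → (k : ℕ) → ℕ → Vec ℕ k
nVec n k z = tabulate (λ i → if does (toℕ i ℕ.<? k ∸ z)
                              then psi (n ∸ z) (k ∸ z) (toℕ i) else 1)

sumVec : ∀ {k} → Vec ℕ k → ℕ
sumVec {zero}  v = 0
sumVec {suc k} v = lookup v Fin.zero ℕ.+ sumVec {k} (tabulate (λ i → lookup v (Fin.suc i)))

record Field (c ℓ : Level) : Set (lsuc (c ⊔ ℓ)) where
  field
    commutativeRing : CommutativeRing c ℓ
  open CommutativeRing commutativeRing public
  field
    0≉1     : ¬ (0# ≈ 1#)
    inverse : ∀ x → ¬ (x ≈ 0#) → Σ Carrier λ y → (x * y ≈ 1#)

module FieldTheory {c ℓ : Level} (L : Field c ℓ) where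
  open Field L

  Σ[<_]_ : (n : ℕ) → (Fin n → Carrier) → Carrier
  Σ[< zero ] f = 0#
  Σ[< suc n ] f = f Fin.zero + Σ[< n ] (λ i → f (Fin.suc i))

  HasCard : ℕ → Set (c ⊔ ℓ)
  HasCard N = Σ (Fin N → Carrier) λ e → ((∀ (i j : Fin N) → e i ≈ e j → i ≡ j) × (∀ x → ∃[ i ] (x ≈ e i)))

  PredHasCard : (Carrier → Set (c ⊔ ℓ)) → ℕ → Set (c ⊔ ℓ)
  PredHasCard P N = Σ (Fin N → Carrier) λ e → ((∀ (i : Fin N) → P (e i)) ×
                            (∀ (i j : Fin N) → e i ≈ e j → i ≡ j) ×
                            (∀ x → P x → ∃[ i ] (x ≈ e i)))

  record IsSubfield (P : Carrier → Set (c ⊔ ℓ)) : Set (c ⊔ ℓ) where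
    field
      resp  : ∀ {x y} → x ≈ y → P x → P y
      has0  : P 0#
      has1  : P 1#
      +-cl  : ∀ {x y} → P x → P y → P (x + y)
      neg-cl : ∀ {x} → P x → P (- x)
      *-cl  : ∀ {x y} → P x → P y → P (x * y)
      inv-cl : ∀ {x y} → P x → x * y ≈ 1# → P y

  module OverSubfield (K : Carrier → Set (c ⊔ ℓ)) where

    -- 𝔽_q(λ) = L : the only subfield containing K and λ is L itself
    Generates : Carrier → Set (lsuc (c ⊔ ℓ))
    Generates λ′ = ∀ (P : Carrier → Set (c ⊔ ℓ)) → IsSubfield P →
                   (∀ x → K x → P x) → P λ′ → ∀ x → P x

    InKSpan : ∀ {r} → (Fin r → Carrier) → Carrier → Set (c ⊔ ℓ)
    InKSpan {r} b y = Σ (Fin r → Carrier) λ a → ((∀ t → K (a t)) × y ≈ Σ[< r ] (λ t → a t * b t))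

    KLinIndep : ∀ {r} → (Fin r → Carrier) → Set (c ⊔ ℓ)
    KLinIndep {r} b = ∀ (a : Fin r → Carrier) → (∀ t → K (a t)) → Σ[< r ] (λ t → a t * b t) ≈ 0# → ∀ t → a t ≈ 0#

    -- rank weight: w(v) = r iff ⟨v₁,…,v_N⟩_K has a K-basis of size r
    RankWeight : ∀ {N} → (Fin N → Carrier) → ℕ → Set (c ⊔ ℓ)
    RankWeight {N} v r = Σ (Fin r → Carrier) λ b → (KLinIndep {r} b × (∀ j → InKSpan b (v j))
                                 × (∀ t → InKSpan v (b t)))

    Nonzero : ∀ {N} → (Fin N → Carrier) → Set ℓ
    Nonzero v = ¬ (∀ j → v j ≈ 0#)

    codeword : ∀ {k N} → (Fin k → Fin N → Carrier) → (Fin k → Carrier) → Fin N → Carrier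
    codeword {k} G x j = Σ[< k ] (λ i → x i * G i j)

    IsGenMatrix : ∀ {k N} → (Fin k → Fin N → Carrier) → Set (c ⊔ ℓ)
    IsGenMatrix {k} G = ∀ (x : Fin k → Carrier) → (∀ j → codeword G x j ≈ 0#) → ∀ i → x i ≈ 0#

    FullWS : ℕ → ∀ {k N} → (Fin k → Fin N → Carrier) → Set (c ⊔ ℓ)
    FullWS m {k} {N} G = ∀ r →
      (Σ (Fin k → Carrier) λ x → (Nonzero (codeword G x) × RankWeight (codeword G x) r)) ⇔ (1 ≤ r × r ≤ m ⊓ N)

    IsFWSCode : ℕ → ∀ {k N} → (Fin k → Fin N → Carrier) → Set (c ⊔ ℓ)
    IsFWSCode m G = IsGenMatrix G × FullWS m G

    ExistsFWSCode : (m n k : ℕ) → Set (c ⊔ ℓ)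
    ExistsFWSCode m n k = Σ (Fin k → Fin n → Carrier) λ G → IsFWSCode m {k} {n} G

  -- block diagonal generator matrix of C_{λ,n}: row i is u_{λ,n_i} on block i
  pow : Carrier → ℕ → Carrier
  pow x zero = 1#
  pow x (suc t) = pow x t * x

  blockGen : Carrier → ∀ {k} (ns : Vec ℕ k) → Fin k → Fin (sumVec ns) → Carrier
  blockGen λ′ {suc k} ns Fin.zero j with splitAt (lookup ns Fin.zero) j
  ... | inj₁ t = pow λ′ (toℕ t)
  ... | inj₂ _ = 0#
  blockGen λ′ {suc k} ns (Fin.suc i) j with splitAt (lookup ns Fin.zero) j
  ... | inj₁ _ = 0#
  ... | inj₂ j′ = blockGen λ′ (tabulate (λ i → lookup ns (Fin.suc i))) i j′

{-# OPTIONS --safe #-}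
module Submission where

-- Rank weight is subadditive: the 𝔽_q-span of the entries of Σ βₛ cₛ lies in the sum of the spans of the
-- entries of the cₛ. If n ≥ 2^k, an FWS code contains codewords of weights 2^k, 2^(k-1), …, 1; each weighs
-- more than all later ones together, so these k + 1 codewords would be linearly independent in a
-- k-dimensional code. Hence n < 2^k.
--
-- Conversely, let n₁, …, n_k ≥ 1 be block lengths with n₁ + ⋯ + n_k = n ≤ m and nᵢ ≤ 1 + nᵢ₊₁ + ⋯ + n_k.
-- The vector n of the statement is such, because the entries of Ψ(u,v) from position i on add up to ⌊u/2^i⌋
-- and ⌈a/2⌉ ≤ 1 + ⌊a/2⌋. Give row i of a block-diagonal generator matrix the i-th segment of an 𝔽_q-independent
-- sequence e₀, …, e_(n-1) (one exists since n ≤ m). For r ≤ n, choosing blocks greedily gives a 0/1 message whose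
-- codeword has exactly r distinct entries of the sequence, hence weight r. C_{λ,n} is this code for eᵢ = λ^i,
-- with rows rescaled by powers of λ, and 1, λ, …, λ^(m-1) are independent: if λ^d ∈ ⟨1, …, λ^(d-1)⟩ with d < m,
-- that span is closed under products and inverses, a subfield containing 𝔽_q and λ with only q^d < q^m elements.

open import Defs
open import Level using (Level; _⊔_; Lift; lift)
open import Data.Nat as ℕ using (ℕ; zero; suc; z≤n; s≤s; _^_; _<_; _≤_)
import Data.Nat.Properties as ℕₚ
open import Data.Fin as Fin using (Fin; zero; suc; toℕ; _↑ˡ_; _↑ʳ_)
import Data.Fin.Properties as Finₚ
open import Data.Vec using (Vec; tabulate; lookup)
open import Data.Vec.Functional using (_++_; _∷_)
import Data.Vec.Functional.Properties as Vecₚ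
open import Data.Product using (Σ; ∃; _,_; proj₁; proj₂; _×_)
open import Data.Sum using (_⊎_; inj₁; inj₂)
open import Data.Empty using (⊥-elim)
open import Data.Unit using (⊤; tt)
open import Function using (_∘_)
open import Relation.Nullary using (¬_; Dec; yes; no)
open import Relation.Binary.PropositionalEquality as ≡ using (_≡_; _≢_; _≗_)
open import Function.Bundles using (_⇔_; mk⇔)
import Algebra.Properties.Semiring.Sum as SemiringSum
import Algebra.Properties.Ring as RingProperties
open import Algebra.Properties.Monoid.Sum ℕₚ.+-0-monoid using () renaming (sum to sumℕ)

module FiniteSums {c ℓ : Level} (L : Field c ℓ) where
  open Field L hiding (zero)
  open FieldTheory L
  open SemiringSum semiring using (sum; sum-cong-≋; sum-replicate-zero; ∑-distrib-+;
                                   *-distribˡ-sum; *-distribʳ-sum; sum-init-last)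
  open RingProperties ring using (-0#≈0#; -‿+-comm; -‿distribʳ-*; -‿distribˡ-*; +-inverseˡ-unique)
  open import Relation.Binary.Reasoning.Setoid setoid

  Σ≡sum : ∀ {n} (f : Fin n → Carrier) → Σ[< n ] f ≡ sum f
  Σ≡sum {zero}  f = ≡.refl
  Σ≡sum {suc n} f = ≡.cong (f zero +_) (Σ≡sum (f ∘ suc))

  Σ-cong : ∀ {n} {f g : Fin n → Carrier} → (∀ i → f i ≈ g i) → Σ[< n ] f ≈ Σ[< n ] g
  Σ-cong {f = f} {g} f≈g rewrite Σ≡sum f | Σ≡sum g = sum-cong-≋ f≈g

  Σ-≈0 : ∀ {n} {f : Fin n → Carrier} → (∀ i → f i ≈ 0#) → Σ[< n ] f ≈ 0#
  Σ-≈0 {n} {f} f≈0 rewrite Σ≡sum f = trans (sum-cong-≋ f≈0) (sum-replicate-zero n)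

  Σ-distrib-+ : ∀ {n} (f g : Fin n → Carrier) → Σ[< n ] (λ i → f i + g i) ≈ Σ[< n ] f + Σ[< n ] g
  Σ-distrib-+ f g rewrite Σ≡sum (λ i → f i + g i) | Σ≡sum f | Σ≡sum g = ∑-distrib-+ f g

  *-distribˡ-Σ : ∀ {n} x (f : Fin n → Carrier) → x * Σ[< n ] f ≈ Σ[< n ] (λ i → x * f i)
  *-distribˡ-Σ x f rewrite Σ≡sum f | Σ≡sum (λ i → x * f i) = *-distribˡ-sum x f

  *-distribʳ-Σ : ∀ {n} x (f : Fin n → Carrier) → Σ[< n ] f * x ≈ Σ[< n ] (λ i → f i * x)
  *-distribʳ-Σ x f rewrite Σ≡sum f | Σ≡sum (λ i → f i * x) = *-distribʳ-sum x f

  Σ-comm : ∀ {m n} (f : Fin m → Fin n → Carrier) →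
           Σ[< m ] (λ i → Σ[< n ] (f i)) ≈ Σ[< n ] (λ j → Σ[< m ] (λ i → f i j))
  Σ-comm {zero}  {n} f = sym (Σ-≈0 {n} (λ _ → refl))
  Σ-comm {suc m} f = trans (+-congˡ (Σ-comm (f ∘ suc))) (sym (Σ-distrib-+ (f zero) _))

  -‿distrib-Σ : ∀ {n} (f : Fin n → Carrier) → - Σ[< n ] f ≈ Σ[< n ] (λ i → - f i)
  -‿distrib-Σ {zero}  f = -0#≈0#
  -‿distrib-Σ {suc n} f = trans (sym (-‿+-comm _ _)) (+-congˡ (-‿distrib-Σ (f ∘ suc)))

  Σ-init-last : ∀ {n} (f : Fin (suc n) → Carrier) →
                Σ[< suc n ] f ≈ Σ[< n ] (f ∘ Fin.inject₁) + f (Fin.fromℕ n)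
  Σ-init-last {n} f rewrite Σ≡sum f | Σ≡sum (f ∘ Fin.inject₁) = sum-init-last f

  Σ-splitAt : ∀ m {n} (f : Fin (m ℕ.+ n) → Carrier) →
              Σ[< m ℕ.+ n ] f ≈ Σ[< m ] (λ i → f (i ↑ˡ n)) + Σ[< n ] (λ j → f (m ↑ʳ j))
  Σ-splitAt zero    f = sym (+-identityˡ _)
  Σ-splitAt (suc m) f = trans (+-congˡ (Σ-splitAt m (f ∘ suc))) (sym (+-assoc _ _ _))

  Σ-single : ∀ {n} (f : Fin n → Carrier) (i : Fin n) → (∀ j → j ≢ i → f j ≈ 0#) → Σ[< n ] f ≈ f i
  Σ-single f zero    f≈0 = trans (+-congˡ (Σ-≈0 (λ j → f≈0 (suc j) (λ ())))) (+-identityʳ _)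
  Σ-single f (suc i) f≈0 =
    trans (+-congʳ (f≈0 zero (λ ())))
          (trans (+-identityˡ _) (Σ-single (f ∘ suc) i (λ j j≢i → f≈0 (suc j) (j≢i ∘ Finₚ.suc-injective))))

  x*-yz≈-xy*z : ∀ x y z → x * - (y * z) ≈ (- (x * y)) * z
  x*-yz≈-xy*z x y z =
    trans (sym (-‿distribʳ-* x (y * z))) (trans (-‿cong (sym (*-assoc x y z))) (-‿distribˡ-* (x * y) z))

  isolate : ∀ {n c y x} (a b : Fin n → Carrier) → c * y ≈ 1# →
            c * x + Σ[< n ] (λ t → a t * b t) ≈ 0# → x ≈ Σ[< n ] (λ t → (- (y * a t)) * b t)
  isolate {n} {c} {y} {x} a b cy≈1 rel = begin
    x                                    ≈⟨ sym (*-identityˡ x) ⟩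
    1# * x                               ≈⟨ *-congʳ (trans (sym cy≈1) (*-comm c y)) ⟩
    (y * c) * x                          ≈⟨ *-assoc y c x ⟩
    y * (c * x)                          ≈⟨ *-congˡ (+-inverseˡ-unique _ _ rel) ⟩
    y * (- Σ[< n ] (λ t → a t * b t))    ≈⟨ *-congˡ (-‿distrib-Σ (λ t → a t * b t)) ⟩
    y * Σ[< n ] (λ t → - (a t * b t))    ≈⟨ *-distribˡ-Σ y (λ t → - (a t * b t)) ⟩
    Σ[< n ] (λ t → y * - (a t * b t))    ≈⟨ Σ-cong {n} (λ t → x*-yz≈-xy*z y (a t) (b t)) ⟩
    Σ[< n ] (λ t → (- (y * a t)) * b t)  ∎

  Σ-row-operation : ∀ {r} (a cs q : Fin r → Carrier) p →
                    Σ[< r ] (λ s → a s * (q s + - (cs s * p))) ≈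
                    (- Σ[< r ] (λ s → a s * cs s)) * p + Σ[< r ] (λ s → a s * q s)
  Σ-row-operation {r} a cs q p = begin
    Σ[< r ] (λ s → a s * (q s + - (cs s * p)))
      ≈⟨ Σ-cong {r} (λ s → trans (distribˡ (a s) _ _) (+-congˡ (x*-yz≈-xy*z (a s) (cs s) p))) ⟩
    Σ[< r ] (λ s → a s * q s + (- (a s * cs s)) * p)
      ≈⟨ Σ-distrib-+ (λ s → a s * q s) (λ s → (- (a s * cs s)) * p) ⟩
    Σ[< r ] (λ s → a s * q s) + Σ[< r ] (λ s → (- (a s * cs s)) * p)
      ≈⟨ +-congˡ (sym (*-distribʳ-Σ p (λ s → - (a s * cs s)))) ⟩
    Σ[< r ] (λ s → a s * q s) + Σ[< r ] (λ s → - (a s * cs s)) * p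
      ≈⟨ +-congˡ (*-congʳ (sym (-‿distrib-Σ (λ s → a s * cs s)))) ⟩
    Σ[< r ] (λ s → a s * q s) + (- Σ[< r ] (λ s → a s * cs s)) * p
      ≈⟨ +-comm _ _ ⟩
    (- Σ[< r ] (λ s → a s * cs s)) * p + Σ[< r ] (λ s → a s * q s)
      ∎

module Powers {c ℓ : Level} (L : Field c ℓ) where
  open Field L hiding (zero)
  open FieldTheory L
  open import Algebra.Properties.CommutativeSemigroup *-commutativeSemigroup using (interchange)

  pow-+ : ∀ x u v → pow x (u ℕ.+ v) ≈ pow x u * pow x v
  pow-+ x u zero    = trans (reflexive (≡.cong (pow x) (ℕₚ.+-identityʳ u))) (sym (*-identityʳ _))
  pow-+ x u (suc v) = trans (reflexive (≡.cong (pow x) (ℕₚ.+-suc u v)))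
                            (trans (*-congʳ (pow-+ x u v)) (*-assoc _ _ _))

  pow-inverse : ∀ {x y} n → x * y ≈ 1# → pow y n * pow x n ≈ 1#
  pow-inverse zero    _      = *-identityˡ 1#
  pow-inverse (suc n) xy≈1 = trans (interchange _ _ _ _)
                                   (trans (*-cong (pow-inverse n xy≈1) (trans (*-comm _ _) xy≈1)) (*-identityˡ 1#))

module Subspaces {c ℓ : Level} (L : Field c ℓ) (_≈?_ : ∀ x y → Dec (Field._≈_ L x y))
                 (K : Field.Carrier L → Set (c ⊔ ℓ)) (K-subfield : FieldTheory.IsSubfield L K) where
  open Field L hiding (zero)
  open FieldTheory L
  open OverSubfield K
  open IsSubfield K-subfield
  open FiniteSums L
  open RingProperties ring using (-‿distribˡ-*)
  open import Relation.Binary.Reasoning.Setoid setoid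

  Σ-closed : ∀ {n} {f : Fin n → Carrier} → (∀ i → K (f i)) → K (Σ[< n ] f)
  Σ-closed {zero}  _  = has0
  Σ-closed {suc n} fK = +-cl (fK zero) (Σ-closed (fK ∘ suc))

  indicator : ∀ {p} {P : Set p} → Dec P → Carrier
  indicator (yes _) = 1#
  indicator (no _)  = 0#

  indicator-closed : ∀ {p} {P : Set p} (d : Dec P) → K (indicator d)
  indicator-closed (yes _) = has1
  indicator-closed (no _)  = has0

  indicator-yes : ∀ {p} {P : Set p} (d : Dec P) → P → indicator d ≈ 1#
  indicator-yes (yes _) _ = refl
  indicator-yes (no ¬p) p = ⊥-elim (¬p p)

  indicator-no : ∀ {p} {P : Set p} (d : Dec P) → ¬ P → indicator d ≈ 0#
  indicator-no (yes p) ¬p = ⊥-elim (¬p p)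
  indicator-no (no _)  _  = refl

  indicator-cong : ∀ {p q} {P : Set p} {Q : Set q} (d : Dec P) (d′ : Dec Q) → (P → Q) → (Q → P) →
                   indicator d ≈ indicator d′
  indicator-cong d (yes q) _   q→p = indicator-yes d (q→p q)
  indicator-cong d (no ¬q) p→q _   = indicator-no d (¬q ∘ p→q)

  Σ-indicator : ∀ {r} (b : Fin r → Carrier) t → Σ[< r ] (λ s → indicator (t Fin.≟ s) * b s) ≈ b t
  Σ-indicator b t =
    trans (Σ-single _ t (λ s s≢t → trans (*-congʳ (indicator-no (t Fin.≟ s) (s≢t ∘ ≡.sym))) (zeroˡ _)))
          (trans (*-congʳ (indicator-yes (t Fin.≟ t) ≡.refl)) (*-identityˡ _))

  InKSpan-resp : ∀ {r} {b : Fin r → Carrier} {x y} → x ≈ y → InKSpan b x → InKSpan b y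
  InKSpan-resp x≈y (a , aK , x≈Σ) = a , aK , trans (sym x≈y) x≈Σ

  InKSpan-0 : ∀ {r} (b : Fin r → Carrier) → InKSpan b 0#
  InKSpan-0 {r} b = (λ _ → 0#) , (λ _ → has0) , sym (Σ-≈0 {r} (λ _ → zeroˡ _))

  InKSpan-member : ∀ {r} (b : Fin r → Carrier) t → InKSpan b (b t)
  InKSpan-member b t =
    (λ s → indicator (t Fin.≟ s)) , (λ s → indicator-closed (t Fin.≟ s)) , sym (Σ-indicator b t)

  InKSpan-+ : ∀ {r} {b : Fin r → Carrier} {x y} → InKSpan b x → InKSpan b y → InKSpan b (x + y)
  InKSpan-+ {r} {b} (a , aK , x≈) (a′ , a′K , y≈) =
    (λ t → a t + a′ t) , (λ t → +-cl (aK t) (a′K t)) ,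
    trans (+-cong x≈ y≈) (sym (trans (Σ-cong {r} (λ t → distribʳ (b t) (a t) (a′ t)))
                                     (Σ-distrib-+ (λ t → a t * b t) (λ t → a′ t * b t))))

  InKSpan-neg : ∀ {r} {b : Fin r → Carrier} {x} → InKSpan b x → InKSpan b (- x)
  InKSpan-neg {r} {b} (a , aK , x≈) =
    (λ t → - a t) , (λ t → neg-cl (aK t)) ,
    trans (-‿cong x≈) (trans (-‿distrib-Σ (λ t → a t * b t)) (Σ-cong {r} (λ t → -‿distribˡ-* (a t) (b t))))

  Σ-substitute : ∀ {n r} (a : Fin n → Carrier) (B : Fin n → Fin r → Carrier) (b : Fin r → Carrier) →
                 Σ[< n ] (λ j → a j * Σ[< r ] (λ t → B j t * b t)) ≈
                 Σ[< r ] (λ t → Σ[< n ] (λ j → a j * B j t) * b t)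
  Σ-substitute {n} {r} a B b = begin
    Σ[< n ] (λ j → a j * Σ[< r ] (λ t → B j t * b t))
      ≈⟨ Σ-cong {n} (λ j → *-distribˡ-Σ (a j) (λ t → B j t * b t)) ⟩
    Σ[< n ] (λ j → Σ[< r ] (λ t → a j * (B j t * b t)))
      ≈⟨ Σ-cong {n} (λ j → Σ-cong {r} (λ t → sym (*-assoc _ _ _))) ⟩
    Σ[< n ] (λ j → Σ[< r ] (λ t → (a j * B j t) * b t))
      ≈⟨ Σ-comm (λ j t → (a j * B j t) * b t) ⟩
    Σ[< r ] (λ t → Σ[< n ] (λ j → (a j * B j t) * b t))
      ≈⟨ Σ-cong {r} (λ t → sym (*-distribʳ-Σ (b t) (λ j → a j * B j t))) ⟩
    Σ[< r ] (λ t → Σ[< n ] (λ j → a j * B j t) * b t)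
      ∎

  InKSpan-trans : ∀ {N r} {v : Fin N → Carrier} {b : Fin r → Carrier} →
                  (∀ j → InKSpan b (v j)) → ∀ {y} → InKSpan v y → InKSpan b y
  InKSpan-trans {N} {v = v} {b} vb (a , aK , y≈) =
    (λ t → Σ[< N ] (λ j → a j * B j t)) ,
    (λ t → Σ-closed (λ j → *-cl (aK j) (proj₁ (proj₂ (vb j)) t))) ,
    trans y≈ (trans (Σ-cong {N} (λ j → *-congˡ (proj₂ (proj₂ (vb j))))) (Σ-substitute a B b))
    where
    B : Fin N → _
    B j = proj₁ (vb j)

  InKSpan-*ˡ : ∀ {r} {b : Fin r → Carrier} {k x} → K k → InKSpan b x → InKSpan b (k * x)
  InKSpan-*ˡ {r} {b} {k} k∈K (a , aK , x≈) =
    (λ t → k * a t) , (λ t → *-cl k∈K (aK t)) ,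
    trans (*-congˡ x≈) (trans (*-distribˡ-Σ k (λ t → a t * b t)) (Σ-cong {r} (λ t → sym (*-assoc k (a t) (b t)))))

  InKSpan-*ʳ : ∀ {r N} {b : Fin r → Carrier} {v : Fin N → Carrier} {y} z →
               (∀ t → InKSpan v (b t * z)) → InKSpan b y → InKSpan v (y * z)
  InKSpan-*ʳ {r} {b = b} z bz∈span (a , aK , y≈) = InKSpan-trans bz∈span
    (a , aK , trans (*-congʳ y≈) (trans (*-distribʳ-Σ z (λ t → a t * b t)) (Σ-cong {r} (λ t → *-assoc (a t) (b t) z))))

  InKSpan-of-relation : ∀ {r} {b : Fin r → Carrier} {c y x} (a : Fin r → Carrier) → (∀ t → K (a t)) →
                        K c → c * y ≈ 1# → c * x + Σ[< r ] (λ t → a t * b t) ≈ 0# → InKSpan b x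
  InKSpan-of-relation {b = b} {c} {y} {x} a aK cK cy≈1 rel =
    (λ t → - (y * a t)) , (λ t → neg-cl (*-cl (inv-cl cK cy≈1) (aK t))) , isolate a b cy≈1 rel

  KLinIndep-resp : ∀ {r} {b b′ : Fin r → Carrier} → (∀ t → b t ≈ b′ t) → KLinIndep b → KLinIndep b′
  KLinIndep-resp {r} b≈b′ ind a aK rel = ind a aK (trans (Σ-cong {r} (λ t → *-congˡ (b≈b′ t))) rel)

  KLinIndep⇒≉0 : ∀ {r} {b : Fin r → Carrier} → KLinIndep b → ∀ t → ¬ (b t ≈ 0#)
  KLinIndep⇒≉0 {b = b} ind t bt≈0 = 0≉1 (sym (trans (sym (indicator-yes (t Fin.≟ t) ≡.refl)) coefficient≈0))
    where
    coefficient≈0 : indicator (t Fin.≟ t) ≈ 0#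
    coefficient≈0 = ind _ (λ s → indicator-closed (t Fin.≟ s)) (trans (Σ-indicator b t) bt≈0) t

  KLinIndep-∘ : ∀ {M r} {b : Fin M → Carrier} (ι : Fin r → Fin M) → (∀ s t → ι s ≡ ι t → s ≡ t) →
                KLinIndep b → KLinIndep (b ∘ ι)
  KLinIndep-∘ {M} {r} {b} ι ι-injective ind a aK rel t = begin
    a t                                          ≈⟨ sym (Σ-indicator a t) ⟩
    Σ[< r ] (λ s → indicator (t Fin.≟ s) * a s)  ≈⟨ Σ-cong {r} (λ s → *-congʳ (same-indicator s)) ⟩
    a′ (ι t)                                     ≈⟨ ind a′ a′K pushforward (ι t) ⟩
    0#                                           ∎
    where
    a′ : Fin M → Carrier
    a′ j = Σ[< r ] (λ s → indicator (ι s Fin.≟ j) * a s)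
    a′K : ∀ j → K (a′ j)
    a′K j = Σ-closed (λ s → *-cl (indicator-closed (ι s Fin.≟ j)) (aK s))
    same-indicator : ∀ s → indicator (t Fin.≟ s) ≈ indicator (ι s Fin.≟ ι t)
    same-indicator s =
      indicator-cong (t Fin.≟ s) (ι s Fin.≟ ι t) (≡.cong ι ∘ ≡.sym) (≡.sym ∘ ι-injective s t)
    pushforward : Σ[< M ] (λ j → a′ j * b j) ≈ 0#
    pushforward = begin
      Σ[< M ] (λ j → a′ j * b j)
        ≈⟨ Σ-cong {M} (λ j → *-distribʳ-Σ (b j) (λ s → indicator (ι s Fin.≟ j) * a s)) ⟩
      Σ[< M ] (λ j → Σ[< r ] (λ s → (indicator (ι s Fin.≟ j) * a s) * b j))
        ≈⟨ Σ-comm (λ j s → (indicator (ι s Fin.≟ j) * a s) * b j) ⟩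
      Σ[< r ] (λ s → Σ[< M ] (λ j → (indicator (ι s Fin.≟ j) * a s) * b j))
        ≈⟨ Σ-cong {r} (λ s → Σ-cong {M} (λ j → *-assoc _ (a s) (b j))) ⟩
      Σ[< r ] (λ s → Σ[< M ] (λ j → indicator (ι s Fin.≟ j) * (a s * b j)))
        ≈⟨ Σ-cong {r} (λ s → Σ-indicator (λ j → a s * b j) (ι s)) ⟩
      Σ[< r ] (λ s → a s * b (ι s))
        ≈⟨ rel ⟩
      0#
        ∎

  prefix : (ℕ → Carrier) → (n : ℕ) → Fin n → Carrier
  prefix e n t = e (toℕ t)

  KLinIndep-prefix-∘ : ∀ {N r} {e : ℕ → Carrier} (ι : Fin r → ℕ) → (∀ s t → ι s ≡ ι t → s ≡ t) →
                       (∀ t → ι t < N) → KLinIndep (prefix e N) → KLinIndep (e ∘ ι)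
  KLinIndep-prefix-∘ {e = e} ι ι-injective ι<N ind =
    KLinIndep-resp (λ t → reflexive (≡.cong e (Finₚ.toℕ-fromℕ< (ι<N t))))
      (KLinIndep-∘ (λ t → Fin.fromℕ< (ι<N t))
                   (λ s t eq → ι-injective s t (≡.trans (≡.sym (Finₚ.toℕ-fromℕ< (ι<N s)))
                                                  (≡.trans (≡.cong toℕ eq) (Finₚ.toℕ-fromℕ< (ι<N t)))))
                   ind)

  Σ-prefix-init-last : ∀ (e : ℕ → Carrier) n (a : Fin (suc n) → Carrier) →
                       Σ[< suc n ] (λ t → a t * prefix e (suc n) t) ≈
                       Σ[< n ] (λ s → a (Fin.inject₁ s) * prefix e n s) + a (Fin.fromℕ n) * e n
  Σ-prefix-init-last e n a =
    trans (Σ-init-last (λ t → a t * e (toℕ t)))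
          (+-cong (Σ-cong {n} (λ s → *-congˡ (reflexive (≡.cong e (Finₚ.toℕ-inject₁ s)))))
                  (*-congˡ (reflexive (≡.cong e (Finₚ.toℕ-fromℕ n)))))

  KLinIndep-prefix-suc : ∀ (e : ℕ → Carrier) n → KLinIndep (prefix e n) → ¬ InKSpan (prefix e n) (e n) →
                   KLinIndep (prefix e (suc n))
  KLinIndep-prefix-suc e n ind e∉span a aK rel = coefficient≈0
    where
    split : Σ[< n ] (λ s → a (Fin.inject₁ s) * prefix e n s) + a (Fin.fromℕ n) * e n ≈ 0#
    split = trans (sym (Σ-prefix-init-last e n a)) rel
    last≈0 : a (Fin.fromℕ n) ≈ 0#
    last≈0 with a (Fin.fromℕ n) ≈? 0#
    ... | yes aₙ≈0 = aₙ≈0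
    ... | no  aₙ≉0 = ⊥-elim (e∉span (InKSpan-of-relation (a ∘ Fin.inject₁) (aK ∘ Fin.inject₁) (aK _)
                                       (proj₂ (inverse _ aₙ≉0)) (trans (+-comm _ _) split)))
    initial≈0 : ∀ s → a (Fin.inject₁ s) ≈ 0#
    initial≈0 = ind (a ∘ Fin.inject₁) (aK ∘ Fin.inject₁)
                    (trans (sym (+-identityʳ _)) (trans (+-congˡ (sym (trans (*-congʳ last≈0) (zeroˡ _)))) split))
    coefficient≈0 : ∀ t → a t ≈ 0#
    coefficient≈0 t with n ℕ.≟ toℕ t
    ... | yes n≡t = ≡.subst (λ u → a u ≈ 0#) (Finₚ.toℕ-injective (≡.trans (Finₚ.toℕ-fromℕ n) n≡t))
                            last≈0
    ... | no  n≢t = ≡.subst (λ u → a u ≈ 0#) (Finₚ.inject₁-lower₁ t n≢t) (initial≈0 _)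

  NontrivialRelation : ∀ {N r} → (Fin r → Fin N → Carrier) → Set (c ⊔ ℓ)
  NontrivialRelation {N} {r} A = Σ (Fin r → Carrier) λ a → (∀ t → K (a t)) × ¬ (∀ t → a t ≈ 0#) ×
                                   (∀ j → Σ[< r ] (λ t → a t * A t j) ≈ 0#)

  private
    unit₀ : ∀ {r} → Fin (suc r) → Carrier
    unit₀ = 1# ∷ λ _ → 0#

    unit₀-relation : ∀ {N r} (A : Fin (suc r) → Fin N → Carrier) → (∀ j → A zero j ≈ 0#) →
                     NontrivialRelation A
    unit₀-relation {r = r} A A₀≈0 =
      unit₀ , (λ { zero → has1 ; (suc _) → has0 }) , (λ unit₀≈0 → 0≉1 (sym (unit₀≈0 zero))) ,
      λ j → trans (+-cong (*-identityˡ _) (Σ-≈0 {r} (λ _ → zeroˡ _))) (trans (+-identityʳ _) (A₀≈0 j))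

  -- Gaussian elimination: pivot on a nonzero coordinate p of the first vector, clear p from the
  -- other vectors, and recurse on them without coordinate p.
  <⇒nontrivialRelation : ∀ {N r} (A : Fin r → Fin N → Carrier) → (∀ t j → K (A t j)) → N < r →
                         NontrivialRelation A
  <⇒nontrivialRelation {zero}  {suc r} A AK _ = unit₀-relation A (λ ())
  <⇒nontrivialRelation {suc N} {suc r} A AK (s≤s N<r) with Finₚ.all? (λ j → A zero j ≈? 0#)
  ... | yes A₀≈0 = unit₀-relation A A₀≈0
  ... | no  A₀≉0 with Finₚ.¬∀⟶∃¬ _ _ (λ j → A zero j ≈? 0#) A₀≉0
  ...   | (p , Ap≉0) = (a₀ ∷ a′) , aK , (λ a≈0 → a′≉0 (a≈0 ∘ suc)) , relation
    where
    y = proj₁ (inverse (A zero p) Ap≉0)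
    yK : K y
    yK = inv-cl (AK zero p) (proj₂ (inverse (A zero p) Ap≉0))
    cs : Fin r → Carrier
    cs s = A (suc s) p * y
    B : Fin r → Fin (suc N) → Carrier
    B s j = A (suc s) j + - (cs s * A zero j)
    Bp≈0 : ∀ s → B s p ≈ 0#
    Bp≈0 s = trans (+-congˡ (-‿cong (trans (*-assoc _ y _)
                   (trans (*-congˡ (trans (*-comm y _) (proj₂ (inverse (A zero p) Ap≉0)))) (*-identityʳ _)))))
                   (-‿inverseʳ _)
    reduced : NontrivialRelation (λ s j → B s (Fin.punchIn p j))
    reduced = <⇒nontrivialRelation _
                (λ s j → +-cl (AK (suc s) _) (neg-cl (*-cl (*-cl (AK (suc s) p) yK) (AK zero _)))) N<r
    a′ = proj₁ reduced
    a′≉0 = proj₁ (proj₂ (proj₂ reduced))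
    a₀ = - Σ[< r ] (λ s → a′ s * cs s)
    aK : ∀ t → K ((a₀ ∷ a′) t)
    aK zero    = neg-cl (Σ-closed (λ s → *-cl (proj₁ (proj₂ reduced) s) (*-cl (AK (suc s) p) yK)))
    aK (suc s) = proj₁ (proj₂ reduced) s
    relation : ∀ j → Σ[< suc r ] (λ t → (a₀ ∷ a′) t * A t j) ≈ 0#
    relation j with p Fin.≟ j
    ... | yes ≡.refl = trans (sym (Σ-row-operation a′ cs _ _))
                             (Σ-≈0 {r} (λ s → trans (*-congˡ (Bp≈0 s)) (zeroʳ _)))
    ... | no  p≢j    = trans (sym (Σ-row-operation a′ cs _ _))
                             (≡.subst (λ i → Σ[< r ] (λ s → a′ s * B s i) ≈ 0#) (Finₚ.punchIn-punchOut p≢j)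
                                      (proj₂ (proj₂ (proj₂ reduced)) (Fin.punchOut p≢j)))

  KLinIndep⇒≤ : ∀ {r N} {b : Fin r → Carrier} {v : Fin N → Carrier} → KLinIndep b →
                (∀ t → InKSpan v (b t)) → r ≤ N
  KLinIndep⇒≤ {r} {N} {b} {v} ind b∈span with r ℕ.≤? N
  ... | yes r≤N = r≤N
  ... | no  r≰N = ⊥-elim (a≉0 (ind a aK combination≈0))
    where
    A : Fin r → Fin N → Carrier
    A t = proj₁ (b∈span t)
    relation = <⇒nontrivialRelation A (λ t → proj₁ (proj₂ (b∈span t))) (ℕₚ.≰⇒> r≰N)
    a = proj₁ relation
    aK = proj₁ (proj₂ relation)
    a≉0 = proj₁ (proj₂ (proj₂ relation))
    combination≈0 : Σ[< r ] (λ t → a t * b t) ≈ 0#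
    combination≈0 = begin
      Σ[< r ] (λ t → a t * b t)
        ≈⟨ Σ-cong {r} (λ t → *-congˡ (proj₂ (proj₂ (b∈span t)))) ⟩
      Σ[< r ] (λ t → a t * Σ[< N ] (λ j → A t j * v j))
        ≈⟨ Σ-substitute a A v ⟩
      Σ[< N ] (λ j → Σ[< r ] (λ t → a t * A t j) * v j)
        ≈⟨ Σ-≈0 {N} (λ j → trans (*-congʳ (proj₂ (proj₂ (proj₂ relation)) j)) (zeroˡ _)) ⟩
      0#
        ∎

  SpannedBy : ∀ {N} → ℕ → (Fin N → Carrier) → Set (c ⊔ ℓ)
  SpannedBy d v = Σ (Fin d → Carrier) λ b → ∀ j → InKSpan b (v j)

  SpannedBy-0 : ∀ {N} → SpannedBy 0 (λ (_ : Fin N) → 0#)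
  SpannedBy-0 = (λ ()) , λ _ → InKSpan-0 (λ ())

  SpannedBy-* : ∀ {N d} {v : Fin N → Carrier} β → SpannedBy d v → SpannedBy d (λ j → β * v j)
  SpannedBy-* {d = d} β (b , v∈span) = (λ t → β * b t) , λ j → scaled (v∈span j)
    where
    scaled : ∀ {x} → InKSpan b x → InKSpan (λ t → β * b t) (β * x)
    scaled (a , aK , x≈) = a , aK , trans (*-congˡ x≈) (trans (*-distribˡ-Σ β (λ t → a t * b t))
                                     (Σ-cong {d} (λ t → trans (sym (*-assoc β (a t) (b t)))
                                       (trans (*-congʳ (*-comm β (a t))) (*-assoc (a t) β (b t))))))

  SpannedBy-+ : ∀ {N d e} {u v : Fin N → Carrier} → SpannedBy d u → SpannedBy e v →
                SpannedBy (d ℕ.+ e) (λ j → u j + v j)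
  SpannedBy-+ {d = d} {e} (b , u∈span) (b′ , v∈span) = (b ++ b′) , λ j → joined (u∈span j) (v∈span j)
    where
    ++-closed : {a : Fin d → Carrier} {a′ : Fin e → Carrier} → (∀ t → K (a t)) → (∀ t → K (a′ t)) →
                ∀ i → K ((a ++ a′) i)
    ++-closed aK a′K i with Fin.splitAt d i
    ... | inj₁ t = aK t
    ... | inj₂ t = a′K t
    joined : ∀ {x y} → InKSpan b x → InKSpan b′ y → InKSpan (b ++ b′) (x + y)
    joined {x} {y} (a , aK , x≈) (a′ , a′K , y≈) = (a ++ a′) , ++-closed aK a′K , (begin
      x + y
        ≈⟨ +-cong x≈ y≈ ⟩
      Σ[< d ] (λ t → a t * b t) + Σ[< e ] (λ t → a′ t * b′ t)
        ≈⟨ sym (+-cong (Σ-cong {d} left) (Σ-cong {e} right)) ⟩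
      Σ[< d ] (λ t → (a ++ a′) (t ↑ˡ e) * (b ++ b′) (t ↑ˡ e)) +
      Σ[< e ] (λ t → (a ++ a′) (d ↑ʳ t) * (b ++ b′) (d ↑ʳ t))
        ≈⟨ sym (Σ-splitAt d (λ i → (a ++ a′) i * (b ++ b′) i)) ⟩
      Σ[< d ℕ.+ e ] (λ i → (a ++ a′) i * (b ++ b′) i)
        ∎)
      where
      left : ∀ t → (a ++ a′) (t ↑ˡ e) * (b ++ b′) (t ↑ˡ e) ≈ a t * b t
      left t = reflexive (≡.cong₂ _*_ (Vecₚ.lookup-++ˡ a a′ t) (Vecₚ.lookup-++ˡ b b′ t))
      right : ∀ t → (a ++ a′) (d ↑ʳ t) * (b ++ b′) (d ↑ʳ t) ≈ a′ t * b′ t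
      right t = reflexive (≡.cong₂ _*_ (Vecₚ.lookup-++ʳ a a′ t) (Vecₚ.lookup-++ʳ b b′ t))

  SpannedBy-Σ : ∀ {N R} (β : Fin R → Carrier) (u : Fin R → Fin N → Carrier) (w : Fin R → ℕ) →
                (∀ s → SpannedBy (w s) (u s)) → SpannedBy (sumℕ w) (λ j → Σ[< R ] (λ s → β s * u s j))
  SpannedBy-Σ {R = zero}  β u w _       = SpannedBy-0
  SpannedBy-Σ {R = suc R} β u w spanned =
    SpannedBy-+ (SpannedBy-* (β zero) (spanned zero)) (SpannedBy-Σ (β ∘ suc) (u ∘ suc) (w ∘ suc) (spanned ∘ suc))

  RankWeight≤ : ∀ {N d r} {v : Fin N → Carrier} → SpannedBy d v → RankWeight v r → r ≤ d
  RankWeight≤ (_ , v∈span) (_ , ind , _ , b∈span) = KLinIndep⇒≤ ind (λ t → InKSpan-trans v∈span (b∈span t))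

  RankWeight≤length : ∀ {N r} {v : Fin N → Carrier} → RankWeight v r → r ≤ N
  RankWeight≤length {v = v} = RankWeight≤ (v , InKSpan-member v)

  RankWeight-Σ≤ : ∀ {N R r} (β : Fin R → Carrier) (u : Fin R → Fin N → Carrier) (w : Fin R → ℕ) →
                  (∀ s → RankWeight (u s) (w s)) →
                  RankWeight (λ j → Σ[< R ] (λ s → β s * u s j)) r → r ≤ sumℕ w
  RankWeight-Σ≤ β u w weights =
    RankWeight≤ (SpannedBy-Σ β u w (λ s → let (b , _ , u∈span , _) = weights s in b , u∈span))

  RankWeight-resp : ∀ {N r} {v w : Fin N → Carrier} → (∀ j → v j ≈ w j) → RankWeight v r → RankWeight w r
  RankWeight-resp v≈w (b , ind , v∈span , b∈span) =
    b , ind , (λ j → InKSpan-resp (v≈w j) (v∈span j)) ,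
    λ t → let (a , aK , b≈) = b∈span t in a , aK , trans b≈ (Σ-cong (λ j → *-congˡ (v≈w j)))

  RankWeight⇒1≤ : ∀ {N r} {v : Fin N → Carrier} → Nonzero v → RankWeight v r → 1 ≤ r
  RankWeight⇒1≤ {r = zero}  v≉0 (_ , _ , v∈span , _) = ⊥-elim (v≉0 (λ j → proj₂ (proj₂ (v∈span j))))
  RankWeight⇒1≤ {r = suc r} _   _                     = s≤s z≤n

  RankWeight-of-support : ∀ {N r} {v : Fin N → Carrier} (b : Fin r → Carrier) → KLinIndep b →
                          (∀ j → v j ≈ 0# ⊎ ∃ λ t → v j ≈ b t) → (∀ t → ∃ λ j → b t ≈ v j) →
                          RankWeight v r
  RankWeight-of-support {v = v} b ind v∈b b∈v = b , ind , v∈span , b∈span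
    where
    v∈span : ∀ j → InKSpan b (v j)
    v∈span j with v∈b j
    ... | inj₁ vj≈0       = InKSpan-resp (sym vj≈0) (InKSpan-0 b)
    ... | inj₂ (t , vj≈b) = InKSpan-resp (sym vj≈b) (InKSpan-member b t)
    b∈span : ∀ t → InKSpan v (b t)
    b∈span t = InKSpan-resp (sym (proj₂ (b∈v t))) (InKSpan-member v (proj₁ (b∈v t)))

  HasWeight : ∀ {k N} → (Fin k → Fin N → Carrier) → ℕ → Set (c ⊔ ℓ)
  HasWeight {k} G r = Σ (Fin k → Carrier) λ x → Nonzero (codeword G x) × RankWeight (codeword G x) r

  codeword-linear : ∀ {k N R} (G : Fin k → Fin N → Carrier) (β : Fin R → Carrier) (x₀ : Fin k → Carrier)
                    (xs : Fin R → Fin k → Carrier) → (∀ i → x₀ i ≈ Σ[< R ] (λ s → β s * xs s i)) →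
                    ∀ j → codeword G x₀ j ≈ Σ[< R ] (λ s → β s * codeword G (xs s) j)
  codeword-linear {k} {N} {R} G β x₀ xs x₀≈ j = begin
    Σ[< k ] (λ i → x₀ i * G i j)
      ≈⟨ Σ-cong {k} (λ i → *-congʳ (x₀≈ i)) ⟩
    Σ[< k ] (λ i → Σ[< R ] (λ s → β s * xs s i) * G i j)
      ≈⟨ Σ-cong {k} (λ i → *-distribʳ-Σ (G i j) (λ s → β s * xs s i)) ⟩
    Σ[< k ] (λ i → Σ[< R ] (λ s → (β s * xs s i) * G i j))
      ≈⟨ Σ-comm (λ i s → (β s * xs s i) * G i j) ⟩
    Σ[< R ] (λ s → Σ[< k ] (λ i → (β s * xs s i) * G i j))
      ≈⟨ Σ-cong {R} (λ s → trans (Σ-cong {k} (λ i → *-assoc (β s) (xs s i) (G i j)))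
                                 (sym (*-distribˡ-Σ (β s) (λ i → xs s i * G i j)))) ⟩
    Σ[< R ] (λ s → β s * Σ[< k ] (λ i → xs s i * G i j))
      ∎

module OnlyIf {c ℓ : Level} (L : Field c ℓ) (_≈?_ : ∀ x y → Dec (Field._≈_ L x y))
              (K : Field.Carrier L → Set (c ⊔ ℓ)) (K-subfield : FieldTheory.IsSubfield L K) where
  open Field L hiding (zero)
  open FieldTheory L
  open OverSubfield K
  open FiniteSums L
  open Subspaces L _≈?_ K K-subfield
  open import Function.Bundles using (Equivalence)

  whole-subfield : IsSubfield (λ _ → Lift (c ⊔ ℓ) ⊤)
  whole-subfield = record { resp = λ _ _ → lift tt ; has0 = lift tt ; has1 = lift tt ; +-cl = λ _ _ → lift tt
                          ; neg-cl = λ _ → lift tt ; *-cl = λ _ _ → lift tt ; inv-cl = λ _ _ → lift tt }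

  module OverL = Subspaces L _≈?_ (λ _ → Lift (c ⊔ ℓ) ⊤) whole-subfield

  dyadic : (r : ℕ) → Fin (suc r) → ℕ
  dyadic r       zero    = 2 ^ r
  dyadic (suc r) (suc i) = dyadic r i

  dyadic-≤ : ∀ r i → dyadic r i ≤ 2 ^ r
  dyadic-≤ r       zero    = ℕₚ.≤-refl
  dyadic-≤ (suc r) (suc i) = ℕₚ.≤-trans (dyadic-≤ r i) (ℕₚ.m≤m+n (2 ^ r) _)

  dyadic-≥1 : ∀ r i → 1 ≤ dyadic r i
  dyadic-≥1 r       zero    = ℕₚ.m^n>0 2 r
  dyadic-≥1 (suc r) (suc i) = dyadic-≥1 r i

  sumℕ-dyadic-tail : ∀ r → sumℕ (dyadic r ∘ suc) < 2 ^ r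
  sumℕ-dyadic-tail zero    = s≤s z≤n
  sumℕ-dyadic-tail (suc r) = ≡.subst (sumℕ (dyadic r) <_) (≡.cong (2 ^ r ℕ.+_) (≡.sym (ℕₚ.+-identityʳ _)))
                                     (ℕₚ.+-monoʳ-< (2 ^ r) (sumℕ-dyadic-tail r))

  module _ {k N} (G : Fin k → Fin N → Carrier) where

    DyadicWeights : ∀ r → (Fin (suc r) → Fin k → Carrier) → Set (c ⊔ ℓ)
    DyadicWeights r X = ∀ t → RankWeight (codeword G (X t)) (dyadic r t)

    -- Otherwise X₀ is an L-combination of the others, whose weights add up to 2^r - 1 < 2^r.
    dyadic-head≈0 : ∀ r (X : Fin (suc r) → Fin k → Carrier) → DyadicWeights r X → ∀ (a : Fin (suc r) → Carrier) →
                    (∀ i → Σ[< suc r ] (λ t → a t * X t i) ≈ 0#) → a zero ≈ 0#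
    dyadic-head≈0 r X weights a rel with a zero ≈? 0#
    ... | yes a₀≈0 = a₀≈0
    ... | no  a₀≉0 = ⊥-elim (ℕₚ.<⇒≱ (sumℕ-dyadic-tail r)
                      (RankWeight-Σ≤ β (λ s → codeword G (X (suc s))) (dyadic r ∘ suc) (weights ∘ suc)
                        (RankWeight-resp (codeword-linear G β (X zero) (X ∘ suc) X₀≈) (weights zero))))
      where
      y = proj₁ (inverse (a zero) a₀≉0)
      β : Fin r → Carrier
      β s = - (y * a (suc s))
      X₀≈ : ∀ i → X zero i ≈ Σ[< r ] (λ s → β s * X (suc s) i)
      X₀≈ i = isolate (a ∘ suc) (λ s → X (suc s) i) (proj₂ (inverse (a zero) a₀≉0)) (rel i)

    dyadic-independent : ∀ r (X : Fin (suc r) → Fin k → Carrier) → DyadicWeights r X → ∀ (a : Fin (suc r) → Carrier) →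
                         (∀ i → Σ[< suc r ] (λ t → a t * X t i) ≈ 0#) → ∀ t → a t ≈ 0#
    dyadic-independent r       X weights a rel zero    = dyadic-head≈0 r X weights a rel
    dyadic-independent (suc r) X weights a rel (suc t) =
      dyadic-independent r (X ∘ suc) (weights ∘ suc) (a ∘ suc) tail-rel t
      where
      a₀X₀≈0 : ∀ i → a zero * X zero i ≈ 0#
      a₀X₀≈0 i = trans (*-congʳ (dyadic-head≈0 (suc r) X weights a rel)) (zeroˡ _)
      tail-rel : ∀ i → Σ[< suc r ] (λ t → a (suc t) * X (suc t) i) ≈ 0#
      tail-rel i = trans (sym (+-identityˡ _)) (trans (+-congʳ (sym (a₀X₀≈0 i))) (rel i))

  FullWS⇒<2^ : ∀ {k n m} (G : Fin k → Fin n → Carrier) → FullWS m G → n ≤ m → n < 2 ^ k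
  FullWS⇒<2^ {k} {n} {m} G fws n≤m with n ℕ.<? 2 ^ k
  ... | yes n<2^k = n<2^k
  ... | no  n≮2^k = ⊥-elim (a≉0 (dyadic-independent G k X weights a rel))
    where
    has-weight : ∀ t → HasWeight G (dyadic k t)
    has-weight t = Equivalence.from (fws (dyadic k t))
                     (dyadic-≥1 k t , ≡.subst (dyadic k t ≤_) (≡.sym (ℕₚ.m≥n⇒m⊓n≡n n≤m))
                                        (ℕₚ.≤-trans (dyadic-≤ k t) (ℕₚ.≮⇒≥ n≮2^k)))
    X : Fin (suc k) → Fin k → Carrier
    X t = proj₁ (has-weight t)
    weights : DyadicWeights G k X
    weights t = proj₂ (proj₂ (has-weight t))
    relation = OverL.<⇒nontrivialRelation X (λ _ _ → lift tt) (ℕₚ.n<1+n k)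
    a = proj₁ relation
    a≉0 = proj₁ (proj₂ (proj₂ relation))
    rel = proj₂ (proj₂ (proj₂ relation))

HasCard⇒≈? : ∀ {c ℓ} (L : Field c ℓ) {N} → FieldTheory.HasCard L N → ∀ x y → Dec (Field._≈_ L x y)
HasCard⇒≈? L (elem , elem-injective , index) x y with proj₁ (index x) Fin.≟ proj₁ (index y)
... | yes same = yes (Field.trans L (proj₂ (index x)) (≡.subst (λ i → Field._≈_ L (elem i) y) (≡.sym same)
                                                              (Field.sym L (proj₂ (index y)))))
... | no  diff = no λ x≈y → diff (elem-injective _ _ (Field.trans L (Field.sym L (proj₂ (index x)))
                                                         (Field.trans L x≈y (proj₂ (index y)))))

module Counting {c ℓ : Level} (L : Field c ℓ) (_≈?_ : ∀ x y → Dec (Field._≈_ L x y))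
                (K : Field.Carrier L → Set (c ⊔ ℓ)) (K-subfield : FieldTheory.IsSubfield L K)
                (q m : ℕ) (K-card : FieldTheory.PredHasCard L K q) (L-card : FieldTheory.HasCard L (q ^ m)) where
  open Field L hiding (zero)
  open FieldTheory L
  open OverSubfield K
  open IsSubfield K-subfield
  open FiniteSums L
  open Subspaces L _≈?_ K K-subfield
  open Powers L
  open import Relation.Binary.Reasoning.Setoid setoid

  private
    elemK : Fin q → Carrier
    elemK = proj₁ K-card
    elemK∈K : ∀ i → K (elemK i)
    elemK∈K = proj₁ (proj₂ K-card)
    indexK : ∀ x → K x → Fin q
    indexK x x∈K = proj₁ (proj₂ (proj₂ (proj₂ K-card)) x x∈K)
    elemK-indexK : ∀ x x∈K → x ≈ elemK (indexK x x∈K)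
    elemK-indexK x x∈K = proj₂ (proj₂ (proj₂ (proj₂ K-card)) x x∈K)
    elemL : Fin (q ^ m) → Carrier
    elemL = proj₁ L-card
    elemL-injective : ∀ i j → elemL i ≈ elemL j → i ≡ j
    elemL-injective = proj₁ (proj₂ L-card)
    indexL : Carrier → Fin (q ^ m)
    indexL x = proj₁ (proj₂ (proj₂ L-card) x)
    elemL-indexL : ∀ x → x ≈ elemL (indexL x)
    elemL-indexL x = proj₂ (proj₂ (proj₂ L-card) x)

  -- A spanning family of size d gives an injection of L into the coefficient vectors K^d.
  spanning⇒q^m≤q^d : ∀ {d} (b : Fin d → Carrier) → (∀ x → InKSpan b x) → q ^ m ≤ q ^ d
  spanning⇒q^m≤q^d {d} b spanning = Finₚ.injective⇒≤ {f = encode} encode-injective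
    where
    coefficients : Fin (q ^ m) → Fin d → Fin q
    coefficients i t = indexK _ (proj₁ (proj₂ (spanning (elemL i))) t)
    encode : Fin (q ^ m) → Fin (q ^ d)
    encode i = Fin.funToFin (coefficients i)
    encode-injective : ∀ {i j} → encode i ≡ encode j → i ≡ j
    encode-injective {i} {j} eq = elemL-injective i j (begin
      elemL i                                             ≈⟨ proj₂ (proj₂ (spanning (elemL i))) ⟩
      Σ[< d ] (λ t → proj₁ (spanning (elemL i)) t * b t)  ≈⟨ Σ-cong {d} (λ t → *-congʳ (same-coefficient t)) ⟩
      Σ[< d ] (λ t → proj₁ (spanning (elemL j)) t * b t)  ≈⟨ proj₂ (proj₂ (spanning (elemL j))) ⟨
      elemL j                                             ∎)
      where
      same-index : ∀ t → coefficients i t ≡ coefficients j t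
      same-index t = ≡.trans (≡.sym (Finₚ.finToFun-funToFin (coefficients i) t))
                             (≡.trans (≡.cong (λ u → Fin.finToFun u t) eq) (Finₚ.finToFun-funToFin (coefficients j) t))
      same-coefficient : ∀ t → proj₁ (spanning (elemL i)) t ≈ proj₁ (spanning (elemL j)) t
      same-coefficient t =
        trans (elemK-indexK _ _) (trans (reflexive (≡.cong elemK (same-index t))) (sym (elemK-indexK _ _)))

  2≤q : 2 ≤ q
  2≤q = distinct⇒2≤ (indexK 0# has0) (indexK 1# has1) λ eq →
          0≉1 (trans (elemK-indexK 0# has0) (trans (reflexive (≡.cong elemK eq)) (sym (elemK-indexK 1# has1))))
    where
    distinct⇒2≤ : ∀ {n} (i j : Fin n) → i ≢ j → 2 ≤ n
    distinct⇒2≤ {suc zero}    zero zero i≢j = ⊥-elim (i≢j ≡.refl)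
    distinct⇒2≤ {suc (suc n)} _    _    _   = s≤s (s≤s z≤n)

  q^-monoʳ-< : ∀ {d e} → d < e → q ^ d < q ^ e
  q^-monoʳ-< = ℕₚ.^-monoʳ-< q 2≤q

  InKSpan? : ∀ {r} (b : Fin r → Carrier) x → Dec (InKSpan b x)
  InKSpan? {r} b x with Finₚ.any? (λ i → x ≈? (Σ[< r ] (λ t → elemK (Fin.finToFun i t) * b t)))
  ... | yes (i , x≈) = yes ((λ t → elemK (Fin.finToFun i t)) , (λ t → elemK∈K _) , x≈)
  ... | no  ¬found   = no λ (a , aK , x≈) → ¬found (Fin.funToFin (λ t → indexK (a t) (aK t)) ,
        trans x≈ (Σ-cong {r} (λ t → *-congʳ (trans (elemK-indexK (a t) (aK t))
                    (reflexive (≡.cong elemK (≡.sym (Finₚ.finToFun-funToFin (λ t → indexK (a t) (aK t)) t))))))))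

  ∃∉span : ∀ {r} → r < m → (b : Fin r → Carrier) → ∃ λ x → ¬ InKSpan b x
  ∃∉span {r} r<m b with Finₚ.all? (λ i → InKSpan? b (elemL i))
  ... | yes all∈span = ⊥-elim (ℕₚ.<⇒≱ (q^-monoʳ-< r<m)
                         (spanning⇒q^m≤q^d b (λ x → InKSpan-resp (sym (elemL-indexL x)) (all∈span (indexL x)))))
  ... | no  ¬all∈span = let (i , ∉span) = Finₚ.¬∀⟶∃¬ _ _ (λ i → InKSpan? b (elemL i)) ¬all∈span in
                         elemL i , ∉span

  independent-sequence : ∀ n → n ≤ m → ∃ λ (e : ℕ → Carrier) → KLinIndep (prefix e n)
  independent-sequence zero    _   = (λ _ → 0#) , λ _ _ _ ()
  independent-sequence (suc n) n<m =
    extended , KLinIndep-prefix-suc extended n (KLinIndep-resp (λ t → sym (agrees t)) independent)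
                 (λ ∈span → x∉span (InKSpan-resp (reflexive (extended-n)) (subst-span ∈span)))
    where
    previous = independent-sequence n (ℕₚ.<⇒≤ n<m)
    e = proj₁ previous
    independent = proj₂ previous
    x = proj₁ (∃∉span n<m (prefix e n))
    x∉span = proj₂ (∃∉span n<m (prefix e n))
    extended : ℕ → Carrier
    extended u with u ℕ.<? n
    ... | yes _ = e u
    ... | no  _ = x
    agrees : ∀ (t : Fin n) → prefix extended n t ≈ prefix e n t
    agrees t with toℕ t ℕ.<? n
    ... | yes _   = refl
    ... | no  t≮n = ⊥-elim (t≮n (Finₚ.toℕ<n t))
    extended-n : extended n ≡ x
    extended-n with n ℕ.<? n
    ... | yes n<n = ⊥-elim (ℕₚ.<-irrefl ≡.refl n<n)
    ... | no  _   = ≡.refl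
    subst-span : ∀ {y} → InKSpan (prefix extended n) y → InKSpan (prefix e n) y
    subst-span (a , aK , y≈) = a , aK , trans y≈ (Σ-cong {n} (λ t → *-congˡ (agrees t)))

  -- Two of the q^m + 1 powers x^0, …, x^(q^m) coincide, so x has finite order.
  inverse-is-power : ∀ {x y} → x * y ≈ 1# → ∃ λ j → y ≈ pow x j
  inverse-is-power {x} {y} xy≈1 with Finₚ.pigeonhole (ℕₚ.n<1+n (q ^ m)) (λ i → indexL (pow x (toℕ i)))
  ... | (i , j , i<j , same-index) = d , (begin
    y                    ≈⟨ sym (*-identityʳ y) ⟩
    y * 1#               ≈⟨ *-congˡ x^[1+d]≈1 ⟨
    y * (pow x d * x)    ≈⟨ *-comm y _ ⟩
    (pow x d * x) * y    ≈⟨ *-assoc _ x y ⟩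
    pow x d * (x * y)    ≈⟨ *-congˡ xy≈1 ⟩
    pow x d * 1#         ≈⟨ *-identityʳ _ ⟩
    pow x d              ∎)
    where
    a = toℕ i
    d = toℕ j ℕ.∸ suc a
    x^a≈x^b : pow x a ≈ pow x (suc a ℕ.+ d)
    x^a≈x^b = trans (elemL-indexL _) (trans (reflexive (≡.cong elemL same-index))
                (trans (sym (elemL-indexL _)) (reflexive (≡.cong (pow x) (≡.sym (ℕₚ.m+[n∸m]≡n i<j))))))
    x^a*x^[1+d]≈x^a : pow x a * pow x (suc d) ≈ pow x a
    x^a*x^[1+d]≈x^a = trans (sym (pow-+ x a (suc d))) (trans (reflexive (≡.cong (pow x) (ℕₚ.+-suc a d))) (sym x^a≈x^b))
    x^[1+d]≈1 : pow x (suc d) ≈ 1#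
    x^[1+d]≈1 = begin
      pow x (suc d)                          ≈⟨ *-identityˡ _ ⟨
      1# * pow x (suc d)                     ≈⟨ *-congʳ (pow-inverse a xy≈1) ⟨
      (pow y a * pow x a) * pow x (suc d)    ≈⟨ *-assoc _ _ _ ⟩
      pow y a * (pow x a * pow x (suc d))    ≈⟨ *-congˡ x^a*x^[1+d]≈x^a ⟩
      pow y a * pow x a                      ≈⟨ pow-inverse a xy≈1 ⟩
      1#                                     ∎

  -- If x^d lies in the span V of 1, x, …, x^(d-1), then V is closed under multiplication by x,
  -- hence under products, and by inverse-is-power under inverses: V is a subfield.
  module PowerSpan (x : Carrier) (d : ℕ) (x^d∈V : InKSpan (prefix (pow x) d) (pow x d)) where
    V : Carrier → Set (c ⊔ ℓ)
    V = InKSpan (prefix (pow x) d)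

    pow-≤∈V : ∀ t → t ≤ d → V (pow x t)
    pow-≤∈V t t≤d with ℕₚ.m≤n⇒m<n∨m≡n t≤d
    ... | inj₁ t<d    = InKSpan-resp (reflexive (≡.cong (pow x) (Finₚ.toℕ-fromℕ< t<d)))
                                     (InKSpan-member _ (Fin.fromℕ< t<d))
    ... | inj₂ ≡.refl = x^d∈V

    *x-closed : ∀ {y} → V y → V (y * x)
    *x-closed = InKSpan-*ʳ x (λ t → pow-≤∈V (suc (toℕ t)) (Finₚ.toℕ<n t))

    pow∈V : ∀ t → V (pow x t)
    pow∈V zero    = pow-≤∈V 0 z≤n
    pow∈V (suc t) = *x-closed (pow∈V t)

    *pow-closed : ∀ {y} → V y → ∀ t → V (y * pow x t)
    *pow-closed y∈V zero    = InKSpan-resp (sym (*-identityʳ _)) y∈V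
    *pow-closed y∈V (suc t) = InKSpan-resp (*-assoc _ _ _) (*x-closed (*pow-closed y∈V t))

    *-closed : ∀ {y z} → V y → V z → V (y * z)
    *-closed {z = z} y∈V z∈V = InKSpan-*ʳ z (λ t → InKSpan-resp (*-comm z _) (*pow-closed z∈V (toℕ t))) y∈V

    subfield : IsSubfield V
    subfield = record
      { resp = InKSpan-resp ; has0 = InKSpan-0 _ ; has1 = pow∈V 0 ; +-cl = InKSpan-+ ; neg-cl = InKSpan-neg
      ; *-cl = *-closed
      ; inv-cl = λ y∈V yz≈1 → let (j , z≈) = inverse-is-power yz≈1 in InKSpan-resp (sym z≈) (powers∈V y∈V j)
      }
      where
      powers∈V : ∀ {y} → V y → ∀ j → V (pow y j)
      powers∈V _   zero    = pow∈V 0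
      powers∈V y∈V (suc j) = *-closed (powers∈V y∈V j) y∈V

    K⊆V : ∀ y → K y → V y
    K⊆V y y∈K = InKSpan-resp (*-identityʳ y) (InKSpan-*ˡ y∈K (pow∈V 0))

  generator-pow∉span : ∀ {x} → Generates x → ∀ d → d < m → ¬ InKSpan (prefix (pow x) d) (pow x d)
  generator-pow∉span {x} generates d d<m x^d∈V = ℕₚ.<⇒≱ (q^-monoʳ-< d<m) (spanning⇒q^m≤q^d _ everything∈V)
    where
    open PowerSpan x d x^d∈V
    everything∈V : ∀ y → V y
    everything∈V = generates V subfield K⊆V (InKSpan-resp (*-identityˡ x) (pow∈V 1))

  generator-powers-independent : ∀ {x} → Generates x → ∀ r → r ≤ m → KLinIndep (prefix (pow x) r)
  generator-powers-independent generates zero    _   = λ _ _ _ ()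
  generator-powers-independent generates (suc r) r<m =
    KLinIndep-prefix-suc (pow _) r (generator-powers-independent generates r (ℕₚ.<⇒≤ r<m))
                         (generator-pow∉span generates r r<m)

-- The tail as sumVec and blockGen recurse on it; it is not definitionally Data.Vec.tail.
rest : ∀ {k} → Vec ℕ (suc k) → Vec ℕ k
rest ns = tabulate (λ i → lookup ns (suc i))

-- nᵢ ≥ 1 and nᵢ ≤ 1 + nᵢ₊₁ + ⋯ + n_k: then every r ≤ n₁ + ⋯ + n_k is a sum of some of the nᵢ.
Complete : ∀ {k} → Vec ℕ k → Set
Complete {zero}  _  = ⊤
Complete {suc k} ns = 1 ≤ lookup ns zero × lookup ns zero ≤ suc (sumVec (rest ns)) × Complete (rest ns)

splitView : ∀ a b (j : Fin (a ℕ.+ b)) → (∃ λ t → j ≡ t ↑ˡ b) ⊎ (∃ λ t → j ≡ a ↑ʳ t)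
splitView a b j with Fin.splitAt a j in eq
... | inj₁ t = inj₁ (t , ≡.sym (Finₚ.splitAt⁻¹-↑ˡ eq))
... | inj₂ t = inj₂ (t , ≡.sym (Finₚ.splitAt⁻¹-↑ʳ eq))

++-injective : ∀ {a b} {f : Fin a → ℕ} {g : Fin b → ℕ} →
               (∀ s t → f s ≡ f t → s ≡ t) → (∀ s t → g s ≡ g t → s ≡ t) → (∀ s t → f s ≢ g t) →
               ∀ i j → (f ++ g) i ≡ (f ++ g) j → i ≡ j
++-injective {a} {b} {f} {g} f-inj g-inj disjoint i j eq with splitView a b i | splitView a b j
... | inj₁ (s , ≡.refl) | inj₁ (t , ≡.refl) =
  ≡.cong (_↑ˡ b) (f-inj s t (≡.trans (≡.sym (Vecₚ.lookup-++ˡ f g s)) (≡.trans eq (Vecₚ.lookup-++ˡ f g t))))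
... | inj₁ (s , ≡.refl) | inj₂ (t , ≡.refl) =
  ⊥-elim (disjoint s t (≡.trans (≡.sym (Vecₚ.lookup-++ˡ f g s)) (≡.trans eq (Vecₚ.lookup-++ʳ f g t))))
... | inj₂ (s , ≡.refl) | inj₁ (t , ≡.refl) =
  ⊥-elim (disjoint t s (≡.trans (≡.sym (Vecₚ.lookup-++ˡ f g t)) (≡.trans (≡.sym eq) (Vecₚ.lookup-++ʳ f g s))))
... | inj₂ (s , ≡.refl) | inj₂ (t , ≡.refl) =
  ≡.cong (a ↑ʳ_) (g-inj s t (≡.trans (≡.sym (Vecₚ.lookup-++ʳ f g s)) (≡.trans eq (Vecₚ.lookup-++ʳ f g t))))

module BlockCodes {c ℓ : Level} (L : Field c ℓ) (_≈?_ : ∀ x y → Dec (Field._≈_ L x y))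
                  (K : Field.Carrier L → Set (c ⊔ ℓ)) (K-subfield : FieldTheory.IsSubfield L K) where
  open Field L hiding (zero)
  open FieldTheory L
  open OverSubfield K
  open FiniteSums L
  open Subspaces L _≈?_ K K-subfield

  blockDiagonal : ∀ {k} (ns : Vec ℕ k) → (Fin k → ℕ → Carrier) → Fin k → Fin (sumVec ns) → Carrier
  blockDiagonal {suc k} ns R zero j with Fin.splitAt (lookup ns zero) j
  ... | inj₁ t = R zero (toℕ t)
  ... | inj₂ _ = 0#
  blockDiagonal {suc k} ns R (suc i) j with Fin.splitAt (lookup ns zero) j
  ... | inj₁ _ = 0#
  ... | inj₂ j′ = blockDiagonal (rest ns) (R ∘ suc) i j′

  blockGen≡blockDiagonal : ∀ λ′ {k} (ns : Vec ℕ k) i j →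
                           blockGen λ′ ns i j ≡ blockDiagonal ns (λ _ → pow λ′) i j
  blockGen≡blockDiagonal λ′ {suc k} ns zero j with Fin.splitAt (lookup ns zero) j
  ... | inj₁ _ = ≡.refl
  ... | inj₂ _ = ≡.refl
  blockGen≡blockDiagonal λ′ {suc k} ns (suc i) j with Fin.splitAt (lookup ns zero) j
  ... | inj₁ _  = ≡.refl
  ... | inj₂ j′ = blockGen≡blockDiagonal λ′ (rest ns) i j′

  module _ {k} (ns : Vec ℕ (suc k)) (R : Fin (suc k) → ℕ → Carrier) (x : Fin (suc k) → Carrier) where
    private
      n₀ = lookup ns zero
      S  = sumVec (rest ns)
      first-↑ˡ : ∀ t → blockDiagonal ns R zero (t ↑ˡ S) ≡ R zero (toℕ t)
      first-↑ˡ t rewrite Finₚ.splitAt-↑ˡ n₀ t S = ≡.refl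
      later-↑ˡ : ∀ i t → blockDiagonal ns R (suc i) (t ↑ˡ S) ≡ 0#
      later-↑ˡ i t rewrite Finₚ.splitAt-↑ˡ n₀ t S = ≡.refl
      first-↑ʳ : ∀ j → blockDiagonal ns R zero (n₀ ↑ʳ j) ≡ 0#
      first-↑ʳ j rewrite Finₚ.splitAt-↑ʳ n₀ S j = ≡.refl
      later-↑ʳ : ∀ i j → blockDiagonal ns R (suc i) (n₀ ↑ʳ j) ≡ blockDiagonal (rest ns) (R ∘ suc) i j
      later-↑ʳ i j rewrite Finₚ.splitAt-↑ʳ n₀ S j = ≡.refl

    codeword-↑ˡ : ∀ t → codeword (blockDiagonal ns R) x (t ↑ˡ S) ≈ x zero * R zero (toℕ t)
    codeword-↑ˡ t = trans (+-cong (*-congˡ (reflexive (first-↑ˡ t)))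
                                  (Σ-≈0 {k} (λ i → trans (*-congˡ (reflexive (later-↑ˡ i t))) (zeroʳ _))))
                          (+-identityʳ _)

    codeword-↑ʳ : ∀ j → codeword (blockDiagonal ns R) x (n₀ ↑ʳ j) ≈
                        codeword (blockDiagonal (rest ns) (R ∘ suc)) (x ∘ suc) j
    codeword-↑ʳ j = trans (+-cong (trans (*-congˡ (reflexive (first-↑ʳ j))) (zeroʳ _))
                                  (Σ-cong {k} (λ i → *-congˡ (reflexive (later-↑ʳ i j)))))
                          (+-identityˡ _)

  blockDiagonal-isGenMatrix : ∀ {k} (ns : Vec ℕ k) (R : Fin k → ℕ → Carrier) → Complete ns →
                              (∀ i → ¬ R i 0 ≈ 0#) → IsGenMatrix (blockDiagonal ns R)
  blockDiagonal-isGenMatrix {suc k} ns R (1≤n₀ , _ , _) R≉0 x cw≈0 zero = cancel (R≉0 zero) (begin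
    x zero * R zero 0                                       ≡⟨ ≡.cong (λ u → x zero * R zero u) (Finₚ.toℕ-fromℕ< 1≤n₀) ⟨
    x zero * R zero (toℕ (Fin.fromℕ< 1≤n₀))                 ≈⟨ codeword-↑ˡ ns R x (Fin.fromℕ< 1≤n₀) ⟨
    codeword (blockDiagonal ns R) x (Fin.fromℕ< 1≤n₀ ↑ˡ _)  ≈⟨ cw≈0 _ ⟩
    0#                                                      ∎)
    where
    open import Relation.Binary.Reasoning.Setoid setoid
    cancel : ∀ {u v} → ¬ v ≈ 0# → u * v ≈ 0# → u ≈ 0#
    cancel {u} {v} v≉0 uv≈0 = let (w , vw≈1) = inverse v v≉0 in
      trans (sym (*-identityʳ u))
            (trans (*-congˡ (sym vw≈1)) (trans (sym (*-assoc u v w)) (trans (*-congʳ uv≈0) (zeroˡ w))))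
  blockDiagonal-isGenMatrix {suc k} ns R (_ , _ , complete) R≉0 x cw≈0 (suc i) =
    blockDiagonal-isGenMatrix (rest ns) (R ∘ suc) complete (R≉0 ∘ suc) (x ∘ suc)
      (λ j → trans (sym (codeword-↑ʳ ns R x j)) (cw≈0 _)) i

  blockDiagonal-scale : ∀ {k} (ns : Vec ℕ k) {R R′ : Fin k → ℕ → Carrier} (d : Fin k → Carrier) →
                        (∀ i t → R′ i t ≈ d i * R i t) →
                        ∀ i j → blockDiagonal ns R′ i j ≈ d i * blockDiagonal ns R i j
  blockDiagonal-scale {suc k} ns d R′≈ zero j with Fin.splitAt (lookup ns zero) j
  ... | inj₁ t = R′≈ zero (toℕ t)
  ... | inj₂ _ = sym (zeroʳ _)
  blockDiagonal-scale {suc k} ns d R′≈ (suc i) j with Fin.splitAt (lookup ns zero) j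
  ... | inj₁ _  = sym (zeroʳ _)
  ... | inj₂ j′ = blockDiagonal-scale (rest ns) (d ∘ suc) (R′≈ ∘ suc) i j′

  HasWeight-rowScaled : ∀ {k N r} {G G′ : Fin k → Fin N → Carrier} (d : Fin k → Carrier) →
                        (∀ i j → G′ i j ≈ d i * G i j) → HasWeight G′ r → HasWeight G r
  HasWeight-rowScaled {k} d G′≈ (x , x≉0 , weight) =
    (λ i → x i * d i) , (λ w≈0 → x≉0 (λ j → trans (same j) (w≈0 j))) , RankWeight-resp same weight
    where
    same : ∀ j → _ ≈ _
    same j = Σ-cong {k} (λ i → trans (*-congˡ (G′≈ i j)) (sym (*-assoc (x i) (d i) _)))

  FullWS-if-all-weights : ∀ {k N m} (G : Fin k → Fin N → Carrier) → N ≤ m →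
                          (∀ r → 1 ≤ r → r ≤ N → HasWeight G r) → FullWS m G
  FullWS-if-all-weights G N≤m has-weight r =
    mk⇔ (λ (_ , x≉0 , weight) →
           RankWeight⇒1≤ x≉0 weight , ≡.subst (r ≤_) (≡.sym m⊓N≡N) (RankWeight≤length weight))
        (λ (1≤r , r≤m⊓N) → has-weight r 1≤r (≡.subst (r ≤_) m⊓N≡N r≤m⊓N))
    where
    m⊓N≡N = ℕₚ.m≥n⇒m⊓n≡n N≤m

  -- Row i carries e (n₁ + ⋯ + nᵢ₋₁ + t) at position t of its block: the blocks use disjoint segments of e.
  segments : ∀ {k} → Vec ℕ k → (ℕ → Carrier) → Fin k → ℕ → Carrier
  segments         ns e zero    t = e t
  segments {suc k} ns e (suc i) t = segments (rest ns) (λ u → e (lookup ns zero ℕ.+ u)) i t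

  segments-start≉0 : ∀ {k} (ns : Vec ℕ k) (e : ℕ → Carrier) → Complete ns →
                     (∀ u → u < sumVec ns → ¬ e u ≈ 0#) → ∀ i → ¬ segments ns e i 0 ≈ 0#
  segments-start≉0 {suc k} ns e (1≤n₀ , _ , _) e≉0 zero = e≉0 0 (ℕₚ.≤-trans 1≤n₀ (ℕₚ.m≤m+n _ _))
  segments-start≉0 {suc k} ns e (_ , _ , complete) e≉0 (suc i) =
    segments-start≉0 (rest ns) _ complete (λ u u< → e≉0 _ (ℕₚ.+-monoʳ-< (lookup ns zero) u<)) i

  segments-geometric : ∀ {k} (ns : Vec ℕ k) λ′ (e : ℕ → Carrier) →
                       (∀ u v → e (u ℕ.+ v) ≈ e u * pow λ′ v) →
                       ∀ i t → segments ns e i t ≈ segments ns e i 0 * pow λ′ t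
  segments-geometric         ns λ′ e geometric zero    t = geometric 0 t
  segments-geometric {suc k} ns λ′ e geometric (suc i) t =
    segments-geometric (rest ns) λ′ _
      (λ u v → trans (reflexive (≡.cong e (≡.sym (ℕₚ.+-assoc (lookup ns zero) u v)))) (geometric _ v)) i t

  segmentCode : ∀ {k} (ns : Vec ℕ k) → (ℕ → Carrier) → Fin k → Fin (sumVec ns) → Carrier
  segmentCode ns e = blockDiagonal ns (segments ns e)

  record Realisation {k} (ns : Vec ℕ k) (e : ℕ → Carrier) (r : ℕ) : Set (c ⊔ ℓ) where
    field
      message            : Fin k → Carrier
      support            : Fin r → ℕ
      support-injective  : ∀ s t → support s ≡ support t → s ≡ t
      support-<          : ∀ t → support t < sumVec ns
      entries-in-support : ∀ j → codeword (segmentCode ns e) message j ≈ 0# ⊎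
                                 ∃ λ t → codeword (segmentCode ns e) message j ≈ e (support t)
      support-in-entries : ∀ t → ∃ λ j → e (support t) ≈ codeword (segmentCode ns e) message j

  module _ {k} (ns : Vec ℕ (suc k)) (e : ℕ → Carrier) where
    private
      n₀ = lookup ns zero
      S  = sumVec (rest ns)
      R  = segments ns e

    Realisation-skip-first : ∀ {r} → Realisation (rest ns) (λ u → e (n₀ ℕ.+ u)) r → Realisation ns e r
    Realisation-skip-first later = record
      { message = x
      ; support = λ t → n₀ ℕ.+ support t
      ; support-injective = λ s t eq → support-injective s t (ℕₚ.+-cancelˡ-≡ n₀ _ _ eq)
      ; support-< = λ t → ℕₚ.+-monoʳ-< n₀ (support-< t)
      ; entries-in-support = entries
      ; support-in-entries = λ t → let (j , eq) = support-in-entries t in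
                                   n₀ ↑ʳ j , trans eq (sym (codeword-↑ʳ ns R x j))
      }
      where
      open Realisation later
      x = 0# ∷ message
      entries : ∀ j → codeword (segmentCode ns e) x j ≈ 0# ⊎
                      ∃ λ t → codeword (segmentCode ns e) x j ≈ e (n₀ ℕ.+ support t)
      entries j with splitView n₀ S j
      ... | inj₁ (t , ≡.refl) = inj₁ (trans (codeword-↑ˡ ns R x t) (zeroˡ _))
      ... | inj₂ (j′ , ≡.refl) with entries-in-support j′
      ...   | inj₁ w≈0       = inj₁ (trans (codeword-↑ʳ ns R x j′) w≈0)
      ...   | inj₂ (t , w≈e) = inj₂ (t , trans (codeword-↑ʳ ns R x j′) w≈e)

    Realisation-take-first : ∀ {r} → Realisation (rest ns) (λ u → e (n₀ ℕ.+ u)) r → Realisation ns e (n₀ ℕ.+ r)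
    Realisation-take-first {r} later = record
      { message = x
      ; support = support′
      ; support-injective = ++-injective (λ _ _ → Finₚ.toℕ-injective)
                              (λ s t eq → support-injective s t (ℕₚ.+-cancelˡ-≡ n₀ _ _ eq))
                              (λ s t eq → ℕₚ.<⇒≱ (Finₚ.toℕ<n s) (≡.subst (n₀ ≤_) (≡.sym eq) (ℕₚ.m≤m+n n₀ _)))
      ; support-< = bounded
      ; entries-in-support = entries
      ; support-in-entries = covered
      }
      where
      open Realisation later
      x = 1# ∷ message
      support′ : Fin (n₀ ℕ.+ r) → ℕ
      support′ = toℕ ++ (λ t → n₀ ℕ.+ support t)
      support′-↑ˡ : ∀ t → support′ (t ↑ˡ r) ≡ toℕ t
      support′-↑ˡ = Vecₚ.lookup-++ˡ (toℕ {n₀}) _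
      support′-↑ʳ : ∀ t → support′ (n₀ ↑ʳ t) ≡ n₀ ℕ.+ support t
      support′-↑ʳ = Vecₚ.lookup-++ʳ (toℕ {n₀}) _
      bounded : ∀ i → support′ i < n₀ ℕ.+ S
      bounded i with splitView n₀ r i
      ... | inj₁ (t , ≡.refl) = ≡.subst (_< n₀ ℕ.+ S) (≡.sym (support′-↑ˡ t))
                                         (ℕₚ.<-≤-trans (Finₚ.toℕ<n t) (ℕₚ.m≤m+n n₀ S))
      ... | inj₂ (t , ≡.refl) = ≡.subst (_< n₀ ℕ.+ S) (≡.sym (support′-↑ʳ t)) (ℕₚ.+-monoʳ-< n₀ (support-< t))
      entries : ∀ j → codeword (segmentCode ns e) x j ≈ 0# ⊎
                      ∃ λ t → codeword (segmentCode ns e) x j ≈ e (support′ t)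
      entries j with splitView n₀ S j
      ... | inj₁ (t , ≡.refl) =
        inj₂ (t ↑ˡ r , trans (codeword-↑ˡ ns R x t)
                             (trans (*-identityˡ _) (reflexive (≡.cong e (≡.sym (support′-↑ˡ t))))))
      ... | inj₂ (j′ , ≡.refl) with entries-in-support j′
      ...   | inj₁ w≈0       = inj₁ (trans (codeword-↑ʳ ns R x j′) w≈0)
      ...   | inj₂ (t , w≈e) = inj₂ (n₀ ↑ʳ t , trans (codeword-↑ʳ ns R x j′)
                                                    (trans w≈e (reflexive (≡.cong e (≡.sym (support′-↑ʳ t))))))
      covered : ∀ i → ∃ λ j → e (support′ i) ≈ codeword (segmentCode ns e) x j
      covered i with splitView n₀ r i
      ... | inj₁ (t , ≡.refl) =
        t ↑ˡ S , trans (reflexive (≡.cong e (support′-↑ˡ t))) (sym (trans (codeword-↑ˡ ns R x t) (*-identityˡ _)))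
      ... | inj₂ (t , ≡.refl) = let (j , eq) = support-in-entries t in
        n₀ ↑ʳ j , trans (reflexive (≡.cong e (support′-↑ʳ t))) (trans eq (sym (codeword-↑ʳ ns R x j)))

  -- Greedy: skip the first block if the later ones can realise r; otherwise take it whole and
  -- realise the remaining r - n₁ ≤ n₂ + ⋯ + n_k with the later blocks.
  realise : ∀ {k} (ns : Vec ℕ k) → Complete ns → ∀ e r → r ≤ sumVec ns → Realisation ns e r
  realise {zero} ns _ e zero _ = record
    { message = λ () ; support = λ () ; support-injective = λ () ; support-< = λ ()
    ; entries-in-support = λ () ; support-in-entries = λ () }
  realise {suc k} ns (_ , n₀≤1+S , complete) e r r≤N with r ℕ.≤? sumVec (rest ns)
  ... | yes r≤S = Realisation-skip-first ns e (realise (rest ns) complete _ r r≤S)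
  ... | no  r≰S = ≡.subst (Realisation ns e) (ℕₚ.m+[n∸m]≡n n₀≤r)
                    (Realisation-take-first ns e (realise (rest ns) complete _ (r ℕ.∸ n₀) (ℕₚ.m≤n+o⇒m∸n≤o r n₀ r≤N)))
    where
    n₀ = lookup ns zero
    n₀≤r : n₀ ≤ r
    n₀≤r = ℕₚ.≤-trans n₀≤1+S (ℕₚ.≰⇒> r≰S)

  segmentCode-hasWeight : ∀ {k} (ns : Vec ℕ k) → Complete ns → ∀ e → KLinIndep (prefix e (sumVec ns)) →
                          ∀ r → 1 ≤ r → r ≤ sumVec ns → HasWeight (segmentCode ns e) r
  segmentCode-hasWeight ns complete e independent r 1≤r r≤N =
    message , nonzero , RankWeight-of-support (e ∘ support) support-independent entries-in-support support-in-entries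
    where
    open Realisation (realise ns complete e r r≤N)
    support-independent : KLinIndep (e ∘ support)
    support-independent = KLinIndep-prefix-∘ {e = e} support support-injective support-< independent
    nonzero : Nonzero (codeword (segmentCode ns e) message)
    nonzero w≈0 = let (j , eq) = support-in-entries (Fin.fromℕ< 1≤r) in
      KLinIndep⇒≉0 support-independent (Fin.fromℕ< 1≤r) (trans eq (w≈0 j))

module Constructions {c ℓ : Level} (L : Field c ℓ) (_≈?_ : ∀ x y → Dec (Field._≈_ L x y))
                     (K : Field.Carrier L → Set (c ⊔ ℓ)) (K-subfield : FieldTheory.IsSubfield L K) where
  open Field L hiding (zero)
  open FieldTheory L
  open OverSubfield K
  open FiniteSums L
  open Subspaces L _≈?_ K K-subfield
  open BlockCodes L _≈?_ K K-subfield
  open Powers L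

  IsGenMatrix-resp : ∀ {k N} {G G′ : Fin k → Fin N → Carrier} → (∀ i j → G i j ≈ G′ i j) →
                     IsGenMatrix G → IsGenMatrix G′
  IsGenMatrix-resp {k} G≈G′ independent x cw≈0 =
    independent x (λ j → trans (Σ-cong {k} (λ i → *-congˡ (G≈G′ i j))) (cw≈0 j))

  segmentCode-isFWS : ∀ {k m} (ns : Vec ℕ k) → Complete ns → sumVec ns ≤ m →
                      ∀ e → KLinIndep (prefix e (sumVec ns)) → IsFWSCode m (segmentCode ns e)
  segmentCode-isFWS ns complete N≤m e independent =
    blockDiagonal-isGenMatrix ns (segments ns e) complete (segments-start≉0 ns e complete e≉0) ,
    FullWS-if-all-weights _ N≤m (segmentCode-hasWeight ns complete e independent)
    where
    e≉0 : ∀ u → u < sumVec ns → ¬ e u ≈ 0#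
    e≉0 u u<N eu≈0 =
      KLinIndep⇒≉0 independent (Fin.fromℕ< u<N) (trans (reflexive (≡.cong e (Finₚ.toℕ-fromℕ< u<N))) eu≈0)

  -- C_{λ,n} is the segment code of the powers of λ with rows rescaled by λ^(n₁ + ⋯ + nᵢ₋₁).
  blockGen-isFWS : ∀ {k m} (ns : Vec ℕ k) → Complete ns → sumVec ns ≤ m →
                   ∀ λ′ → KLinIndep (prefix (pow λ′) (sumVec ns)) → IsFWSCode m (blockGen λ′ ns)
  blockGen-isFWS ns complete N≤m λ′ independent =
    IsGenMatrix-resp (λ i j → reflexive (≡.sym (blockGen≡blockDiagonal λ′ ns i j)))
      (blockDiagonal-isGenMatrix ns (λ _ → pow λ′) complete (λ _ 1≈0 → 0≉1 (sym 1≈0))) ,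
    FullWS-if-all-weights _ N≤m (λ r 1≤r r≤N →
      HasWeight-rowScaled scale rescaled (segmentCode-hasWeight ns complete (pow λ′) independent r 1≤r r≤N))
    where
    scale : Fin _ → Carrier
    scale i = segments ns (pow λ′) i 0
    rescaled : ∀ i j → segmentCode ns (pow λ′) i j ≈ scale i * blockGen λ′ ns i j
    rescaled i j = trans (blockDiagonal-scale ns scale (segments-geometric ns λ′ (pow λ′) (pow-+ λ′)) i j)
                         (*-congˡ (reflexive (≡.sym (blockGen≡blockDiagonal λ′ ns i j))))

module BlockLengths where
  open import Data.Nat using (_+_; _∸_; ⌊_/2⌋; ⌈_/2⌉)
  open import Data.Nat.DivMod using (_/_)
  import Data.Nat.DivMod as DivMod
  import Data.Vec.Properties as Vecₚ′
  open import Data.Bool using (if_then_else_)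
  open import Relation.Nullary using (does)
  open import Relation.Nullary.Decidable using (_×-dec_; _⊎-dec_)
  import Relation.Nullary.Decidable as Dec

  sumBelow : ℕ → (ℕ → ℕ) → ℕ
  sumBelow zero    g = 0
  sumBelow (suc k) g = g 0 + sumBelow k (g ∘ suc)

  sumBelow-+ : ∀ a b g → sumBelow (a + b) g ≡ sumBelow a g + sumBelow b (λ l → g (a + l))
  sumBelow-+ zero    b g = ≡.refl
  sumBelow-+ (suc a) b g = ≡.trans (≡.cong (g 0 +_) (sumBelow-+ a b (g ∘ suc))) (≡.sym (ℕₚ.+-assoc (g 0) _ _))

  sumBelow-cong : ∀ a {g h} → (∀ l → l < a → g l ≡ h l) → sumBelow a g ≡ sumBelow a h
  sumBelow-cong zero    _   = ≡.refl
  sumBelow-cong (suc a) g≡h = ≡.cong₂ _+_ (g≡h 0 (s≤s z≤n)) (sumBelow-cong a (λ l l<a → g≡h (suc l) (s≤s l<a)))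

  sumBelow-mono : ∀ {a b} g → a ≤ b → sumBelow a g ≤ sumBelow b g
  sumBelow-mono {a} {b} g a≤b = ≡.subst (sumBelow a g ≤_)
    (≡.sym (≡.trans (≡.cong (λ c → sumBelow c g) (≡.sym (ℕₚ.m+[n∸m]≡n a≤b))) (sumBelow-+ a (b ∸ a) g)))
    (ℕₚ.m≤m+n _ _)

  sumBelow-1 : ∀ z → sumBelow z (λ _ → 1) ≡ z
  sumBelow-1 zero    = ≡.refl
  sumBelow-1 (suc z) = ≡.cong suc (sumBelow-1 z)

  lookup-rest : ∀ {k} (ns : Vec ℕ (suc k)) i → lookup (rest ns) i ≡ lookup ns (suc i)
  lookup-rest ns = Vecₚ′.lookup∘tabulate (λ i → lookup ns (suc i))

  rest-cong : ∀ {k} (v w : Vec ℕ (suc k)) → lookup v ≗ lookup w → lookup (rest v) ≗ lookup (rest w)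
  rest-cong v w v≗w i = ≡.trans (lookup-rest v i) (≡.trans (v≗w (suc i)) (≡.sym (lookup-rest w i)))

  sumVec-cong : ∀ {k} (v w : Vec ℕ k) → lookup v ≗ lookup w → sumVec v ≡ sumVec w
  sumVec-cong {zero}  v w v≗w = ≡.refl
  sumVec-cong {suc k} v w v≗w = ≡.cong₂ _+_ (v≗w zero) (sumVec-cong (rest v) (rest w) (rest-cong v w v≗w))

  Complete-cong : ∀ {k} (v w : Vec ℕ k) → lookup v ≗ lookup w → Complete v → Complete w
  Complete-cong {zero}  v w v≗w _ = tt
  Complete-cong {suc k} v w v≗w (1≤v₀ , v₀≤ , complete) =
    ≡.subst (1 ≤_) (v≗w zero) 1≤v₀ ,
    ≡.subst₂ (λ a b → a ≤ suc b) (v≗w zero) (sumVec-cong (rest v) (rest w) (rest-cong v w v≗w)) v₀≤ ,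
    Complete-cong (rest v) (rest w) (rest-cong v w v≗w) complete

  rest-tabulate : ∀ {k} (g : ℕ → ℕ) → lookup (rest (tabulate {n = suc k} (g ∘ toℕ))) ≗ lookup (tabulate (g ∘ suc ∘ toℕ))
  rest-tabulate g i = ≡.trans (lookup-rest (tabulate (g ∘ toℕ)) i)
    (≡.trans (Vecₚ′.lookup∘tabulate (g ∘ toℕ) (suc i)) (≡.sym (Vecₚ′.lookup∘tabulate (g ∘ suc ∘ toℕ) i)))

  sumVec-tabulate : ∀ k (g : ℕ → ℕ) → sumVec (tabulate {n = k} (g ∘ toℕ)) ≡ sumBelow k g
  sumVec-rest-tabulate : ∀ k (g : ℕ → ℕ) → sumVec (rest (tabulate {n = suc k} (g ∘ toℕ))) ≡ sumBelow k (g ∘ suc)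

  sumVec-tabulate zero    g = ≡.refl
  sumVec-tabulate (suc k) g = ≡.cong (g 0 +_) (sumVec-rest-tabulate k g)

  sumVec-rest-tabulate k g =
    ≡.trans (sumVec-cong {k} _ (tabulate (g ∘ suc ∘ toℕ)) (rest-tabulate g)) (sumVec-tabulate k (g ∘ suc))

  Complete-tabulate : ∀ k (g : ℕ → ℕ) →
                      (∀ i → i < k → 1 ≤ g i × g i ≤ suc (sumBelow (k ∸ suc i) (λ l → g (suc i + l)))) →
                      Complete (tabulate {n = k} (g ∘ toℕ))
  Complete-tabulate zero    g _       = tt
  Complete-tabulate (suc k) g bounds =
    proj₁ (bounds 0 (s≤s z≤n)) ,
    ≡.subst (λ s → g 0 ≤ suc s) (≡.sym (sumVec-rest-tabulate k g)) (proj₂ (bounds 0 (s≤s z≤n))) ,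
    Complete-cong (tabulate (g ∘ suc ∘ toℕ)) _ (≡.sym ∘ rest-tabulate g)
                  (Complete-tabulate k (g ∘ suc) (λ i i<k → bounds (suc i) (s≤s i<k)))

  x/2≡⌊x/2⌋ : ∀ x → x / 2 ≡ ⌊ x /2⌋
  x/2≡⌊x/2⌋ zero          = ≡.refl
  x/2≡⌊x/2⌋ (suc zero)    = ≡.refl
  x/2≡⌊x/2⌋ (suc (suc x)) = ≡.trans (DivMod.m/n≡1+[m∸n]/n {suc (suc x)} {2} (s≤s (s≤s z≤n))) (≡.cong suc (x/2≡⌊x/2⌋ x))

  ⌈x/2⌉≤1+⌊x/2⌋ : ∀ x → ⌈ x /2⌉ ≤ suc ⌊ x /2⌋
  ⌈x/2⌉≤1+⌊x/2⌋ zero          = z≤n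
  ⌈x/2⌉≤1+⌊x/2⌋ (suc zero)    = s≤s z≤n
  ⌈x/2⌉≤1+⌊x/2⌋ (suc (suc x)) = s≤s (⌈x/2⌉≤1+⌊x/2⌋ x)

  if-yes : ∀ {p} {P : Set p} (d : Dec P) {x y : ℕ} → P → (if does d then x else y) ≡ x
  if-yes (yes _) _  = ≡.refl
  if-yes (no ¬p) p  = ⊥-elim (¬p p)

  if-no : ∀ {p} {P : Set p} (d : Dec P) {x y : ℕ} → ¬ P → (if does d then x else y) ≡ y
  if-no (yes p) ¬p = ⊥-elim (¬p p)
  if-no (no _)  _  = ≡.refl

  module Ψ-entries (u v : ℕ) where
    halving : ℕ → ℕ
    halving i = _/_ u (2 ^ i) {{ℕₚ.m^n≢0 2 i}}

    halving-suc : ∀ i → halving (suc i) ≡ ⌊ halving i /2⌋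
    halving-suc i =
      ≡.trans (DivMod./-congʳ {{ℕₚ.m^n≢0 2 (suc i)}} {{2^i*2≢0}} (ℕₚ.*-comm 2 (2 ^ i)))
              (≡.trans (≡.sym (DivMod.m/n/o≡m/[n*o] u (2 ^ i) 2 {{ℕₚ.m^n≢0 2 i}} {{_}} {{2^i*2≢0}}))
                       (x/2≡⌊x/2⌋ (halving i)))
      where
      2^i*2≢0 = ℕₚ.m*n≢0 (2 ^ i) 2 {{ℕₚ.m^n≢0 2 i}}

    psi-init : ∀ i → suc i < v → psi u v i ≡ ⌈ halving i /2⌉
    psi-init i 1+i<v = ≡.trans (if-no (suc i ℕ.≟ v) (λ eq → ℕₚ.<-irrefl eq 1+i<v))
                               (≡.trans (≡.cong (_/ 2) (ℕₚ.+-comm (halving i) 1)) (x/2≡⌊x/2⌋ (suc (halving i))))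

    psi-last : ∀ i → suc i ≡ v → psi u v i ≡ halving i
    psi-last i 1+i≡v = ≡.trans (if-yes (suc i ℕ.≟ v) 1+i≡v) (≡.cong halving (≡.cong (_∸ 1) (≡.sym 1+i≡v)))

    -- Telescopes, since ⌈a/2⌉ + ⌊a/2⌋ = a and ⌊⌊u/2^i⌋/2⌋ = ⌊u/2^(i+1)⌋.
    psi-suffix : ∀ d i → suc (i + d) ≡ v → sumBelow (suc d) (λ l → psi u v (i + l)) ≡ halving i
    psi-suffix zero    i 1+i+0≡v = ≡.trans (ℕₚ.+-identityʳ _) (≡.trans (≡.cong (psi u v) (ℕₚ.+-identityʳ i))
                                     (psi-last i (≡.trans (≡.cong suc (≡.sym (ℕₚ.+-identityʳ i))) 1+i+0≡v)))
    psi-suffix (suc d) i 1+i+d≡v = begin-equality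
      psi u v (i + 0) + sumBelow (suc d) (λ l → psi u v (i + suc l))
        ≡⟨ ≡.cong₂ _+_ (≡.cong (psi u v) (ℕₚ.+-identityʳ i))
                       (sumBelow-cong (suc d) (λ l _ → ≡.cong (psi u v) (ℕₚ.+-suc i l))) ⟩
      psi u v i + sumBelow (suc d) (λ l → psi u v (suc i + l))
        ≡⟨ ≡.cong₂ _+_ (psi-init i 1+i<v) (psi-suffix d (suc i) (≡.trans (≡.cong suc (≡.sym (ℕₚ.+-suc i d))) 1+i+d≡v)) ⟩
      ⌈ halving i /2⌉ + halving (suc i)
        ≡⟨ ≡.trans (≡.cong (⌈ halving i /2⌉ +_) (halving-suc i)) (ℕₚ.+-comm ⌈ halving i /2⌉ _) ⟩
      ⌊ halving i /2⌋ + ⌈ halving i /2⌉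
        ≡⟨ ℕₚ.⌊n/2⌋+⌈n/2⌉≡n (halving i) ⟩
      halving i ∎
      where
      open ℕₚ.≤-Reasoning
      1+i<v : suc i < v
      1+i<v = ≡.subst (suc i <_) 1+i+d≡v (s≤s (≡.subst (suc i ≤_) (≡.sym (ℕₚ.+-suc i d)) (s≤s (ℕₚ.m≤m+n i d))))

  module Lengths (u v z : ℕ) (1≤v : 1 ≤ v) (lo : 2 ^ (v ∸ 1) ≤ u) (hi : u < 2 ^ v) where
    open Ψ-entries u v

    len : ℕ → ℕ
    len i = if does (i ℕ.<? v) then psi u v i else 1

    len-< : ∀ {i} → i < v → len i ≡ psi u v i
    len-< {i} = if-yes (i ℕ.<? v)

    len-≥ : ∀ {i} → ¬ i < v → len i ≡ 1
    len-≥ {i} = if-no (i ℕ.<? v)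

    1+[v∸1]≡v : suc (v ∸ 1) ≡ v
    1+[v∸1]≡v = ℕₚ.m+[n∸m]≡n 1≤v

    sum-len : sumBelow (v + z) len ≡ u + z
    sum-len = ≡.trans (sumBelow-+ v z len) (≡.cong₂ _+_ Ψ-sum ones)
      where
      Ψ-sum : sumBelow v len ≡ u
      Ψ-sum = ≡.trans (sumBelow-cong v (λ _ → len-<))
                (≡.trans (≡.cong (λ w → sumBelow w (psi u v)) (≡.sym 1+[v∸1]≡v))
                  (≡.trans (psi-suffix (v ∸ 1) 0 1+[v∸1]≡v) (DivMod.n/1≡n u)))
      ones : sumBelow z (λ l → len (v + l)) ≡ z
      ones = ≡.trans (sumBelow-cong z (λ l _ → len-≥ (ℕₚ.≤⇒≯ (ℕₚ.m≤m+n v l)))) (sumBelow-1 z)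

    halving≥1 : ∀ i → i ≤ v ∸ 1 → 1 ≤ halving i
    halving≥1 i i≤ = DivMod.m≥n⇒m/n>0 {{ℕₚ.m^n≢0 2 i}} (ℕₚ.≤-trans (ℕₚ.^-monoʳ-≤ 2 i≤) lo)

    halving-last≤1 : halving (v ∸ 1) ≤ 1
    halving-last≤1 = ℕₚ.<⇒≤pred (DivMod.m<n*o⇒m/o<n {{ℕₚ.m^n≢0 2 (v ∸ 1)}}
                                   (≡.subst (u <_) (≡.cong (2 ^_) (≡.sym 1+[v∸1]≡v)) hi))

    InRange : ℕ → ℕ → Set
    InRange i w = 1 ≤ w × w ≤ suc (sumBelow ((v + z) ∸ suc i) (λ l → len (suc i + l)))

    len-inRange-init : ∀ i → suc i < v → InRange i (len i)
    len-inRange-init i 1+i<v = ≡.subst (InRange i) (≡.sym (≡.trans (len-< i<v) (psi-init i 1+i<v)))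
      (ℕₚ.⌈n/2⌉-mono (halving≥1 i (ℕₚ.<⇒≤pred i<v)) ,
       ℕₚ.≤-trans (⌈x/2⌉≤1+⌊x/2⌋ (halving i))
                  (s≤s (≡.subst (_≤ laterSum) suffix≡ (sumBelow-mono (λ l → len (suc i + l)) suffix≤))))
      where
      i<v = ℕₚ.<-trans (ℕₚ.n<1+n i) 1+i<v
      laterSum = sumBelow ((v + z) ∸ suc i) (λ l → len (suc i + l))
      d = v ∸ suc (suc i)
      1+[1+i+d]≡v : suc (suc i + d) ≡ v
      1+[1+i+d]≡v = ℕₚ.m+[n∸m]≡n 1+i<v
      suffix≡ : sumBelow (suc d) (λ l → len (suc i + l)) ≡ ⌊ halving i /2⌋
      suffix≡ = ≡.trans (sumBelow-cong (suc d) (λ l l<1+d → len-< (≡.subst (suc i + l <_) 1+[1+i+d]≡v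
                                                                   (s≤s (ℕₚ.+-monoʳ-≤ (suc i) (ℕₚ.<⇒≤pred l<1+d))))))
                        (≡.trans (psi-suffix d (suc i) 1+[1+i+d]≡v) (halving-suc i))
      suffix≤ : suc d ≤ (v + z) ∸ suc i
      suffix≤ = ≡.subst (_≤ (v + z) ∸ suc i) (ℕₚ.+-∸-assoc 1 1+i<v) (ℕₚ.∸-monoˡ-≤ (suc i) (ℕₚ.m≤m+n v z))

    len-inRange : ∀ i → i < v + z → InRange i (len i)
    len-inRange i _ with i ℕ.<? v
    ... | no  i≮v = ≡.subst (InRange i) (≡.sym (len-≥ i≮v)) (s≤s z≤n , s≤s z≤n)
    ... | yes i<v with suc i ℕ.≟ v
    ...   | no  1+i≢v = len-inRange-init i (ℕₚ.≤∧≢⇒< i<v 1+i≢v)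
    ...   | yes 1+i≡v = ≡.subst (InRange i) (≡.sym (≡.trans (len-< i<v) (psi-last i 1+i≡v)))
                          (≡.subst (λ j → InRange i (halving j)) (≡.cong (_∸ 1) (≡.sym 1+i≡v))
                             (halving≥1 (v ∸ 1) ℕₚ.≤-refl , ℕₚ.≤-trans halving-last≤1 (s≤s z≤n)))

  InS? : ∀ n k i → Dec (InS n k i)
  InS? n k i = ((i ℕ.<? k) ×-dec (2 ^ (k ∸ suc i) + i ℕ.≤? n)) ⊎-dec ((k ℕ.≤? i) ×-dec (i ℕ.<? n))

  IsMinS-exists : ∀ {n k} → k < n → ∃ (IsMinS n k)
  IsMinS-exists {n} {k} k<n =
    smallest (Finₚ.¬∀⟶∃¬-smallest (suc k) (λ i → ¬ InS n k (toℕ i)) (λ i → Dec.¬? (InS? n k (toℕ i))) k∈S)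
    where
    k∈S : ¬ (∀ (i : Fin (suc k)) → ¬ InS n k (toℕ i))
    k∈S none = none (Fin.fromℕ k) (≡.subst (InS n k) (≡.sym (Finₚ.toℕ-fromℕ k)) (inj₂ (ℕₚ.≤-refl , k<n)))
    smallest : (∃ λ i → ¬ ¬ InS n k (toℕ i) × ((j : Fin.Fin′ i) → ¬ InS n k (toℕ (Fin.inject j)))) → ∃ (IsMinS n k)
    smallest (i , ¬¬i∈S , smaller∉S) =
      toℕ i , Dec.decidable-stable (InS? n k (toℕ i)) ¬¬i∈S ,
      λ j j<i → ≡.subst (λ l → ¬ InS n k l) (≡.trans (Finₚ.toℕ-inject (Fin.fromℕ< j<i)) (Finₚ.toℕ-fromℕ< j<i))
                        (smaller∉S (Fin.fromℕ< j<i))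

  n∸z<2^[k∸z] : ∀ {n k} z → n < 2 ^ k → (∀ i → i < z → ¬ InS n k i) → z < k → n ∸ z < 2 ^ (k ∸ z)
  n∸z<2^[k∸z] zero        n<2^k _         _   = n<2^k
  n∸z<2^[k∸z] {n} {k} (suc z) _ smaller∉S 1+z<k with 2 ^ (k ∸ suc z) + z ℕ.≤? n
  ... | yes z∈S = ⊥-elim (smaller∉S z (ℕₚ.n<1+n z) (inj₁ (ℕₚ.<-trans (ℕₚ.n<1+n z) 1+z<k , z∈S)))
  ... | no  z∉S = ℕₚ.≤-<-trans (ℕₚ.∸-monoʳ-≤ n (ℕₚ.n≤1+n z))
                    (ℕₚ.m<n+o⇒m∸n<o n z {{ℕₚ.m^n≢0 2 (k ∸ suc z)}} (≡.subst (n <_) (ℕₚ.+-comm _ z) (ℕₚ.≰⇒> z∉S)))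

  -- With u = n - z and v = k - z, membership of z in S gives 2^(v-1) ≤ u, and minimality gives u < 2^v.
  nVec-sum-complete : ∀ {n k z} → 1 < k → k < n → n < 2 ^ k → IsMinS n k z →
                      sumVec (nVec n k z) ≡ n × Complete (nVec n k z)
  nVec-sum-complete {n} {suc k′} {z} _ k<n n<2^k (z∈S , smaller∉S) =
    ≡.trans (sumVec-tabulate k len)
            (≡.trans (≡.cong (λ w → sumBelow w len) (≡.sym v+z≡k)) (≡.trans sum-len u+z≡n)) ,
    ≡.subst (λ w → Complete (tabulate {n = w} (len ∘ toℕ))) v+z≡k (Complete-tabulate (v + z) len len-inRange)
    where
    k = suc k′
    u = n ∸ z
    v = k ∸ z
    k′∈S : InS n k k′
    k′∈S = inj₁ (ℕₚ.n<1+n k′ , ≡.subst (λ w → 2 ^ w + k′ ≤ n) (≡.sym (ℕₚ.n∸n≡0 k′)) (ℕₚ.<⇒≤ k<n))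
    z<k : z < k
    z<k with z ℕ.≤? k′
    ... | yes z≤k′ = s≤s z≤k′
    ... | no  z≰k′ = ⊥-elim (smaller∉S k′ (ℕₚ.≰⇒> z≰k′) k′∈S)
    v+z≡k : v + z ≡ k
    v+z≡k = ℕₚ.m∸n+n≡m (ℕₚ.<⇒≤ z<k)
    u+z≡n : u + z ≡ n
    u+z≡n = ℕₚ.m∸n+n≡m (ℕₚ.<⇒≤ (ℕₚ.<-trans z<k k<n))
    lo : 2 ^ (v ∸ 1) ≤ u
    lo = from-S z∈S
      where
      from-S : InS n k z → 2 ^ (v ∸ 1) ≤ u
      from-S (inj₁ (_ , 2^+z≤n)) = ℕₚ.m+n≤o⇒m≤o∸n _
                                     (≡.subst (λ w → 2 ^ w + z ≤ n)
                                              (≡.trans (≡.cong (k ∸_) (ℕₚ.+-comm 1 z)) (≡.sym (ℕₚ.∸-+-assoc k z 1))) 2^+z≤n)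
      from-S (inj₂ (k≤z , _))    = ⊥-elim (ℕₚ.<⇒≱ z<k k≤z)
    open Lengths u v z (ℕₚ.m<n⇒0<n∸m z<k) lo (n∸z<2^[k∸z] z n<2^k smaller∉S z<k)

proposition3p10 : ∀ {c ℓ : Level} (L : Field c ℓ) →
    let open Field L
        open FieldTheory L
    in (K : Carrier → Set (c ⊔ ℓ)) → IsSubfield K →
       let open OverSubfield K
       in (q m n k : ℕ) → IsPrimePower q → PredHasCard K q → HasCard (q ^ m) →
          1 < k → k < n → n ≤ m →
          (ExistsFWSCode m n k ⇔ n < 2 ^ k)
          × (n < 2 ^ k → ∀ λ′ → Generates λ′ → ∀ z → IsMinS n k z →
               (sumVec (nVec n k z) ≡ n) × IsFWSCode m (blockGen λ′ (nVec n k z)))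
proposition3p10 L K K-subfield q m n k _ K-card L-card 1<k k<n n≤m =
  mk⇔ (λ (G , _ , fws) → FullWS⇒<2^ G fws n≤m) exists , C-λ-n-isFWS
  where
  open Field L
  open FieldTheory L
  open OverSubfield K
  _≈?_ = HasCard⇒≈? L L-card
  open OnlyIf L _≈?_ K K-subfield using (FullWS⇒<2^)
  open Counting L _≈?_ K K-subfield q m K-card L-card using (independent-sequence; generator-powers-independent)
  open BlockCodes L _≈?_ K K-subfield using (segmentCode)
  open Constructions L _≈?_ K K-subfield using (segmentCode-isFWS; blockGen-isFWS)
  open BlockLengths using (IsMinS-exists; nVec-sum-complete)

  ≤m : ∀ {N} → N ≡ n → N ≤ m
  ≤m N≡n = ≡.subst (_≤ m) (≡.sym N≡n) n≤m

  exists : n < 2 ^ k → ExistsFWSCode m n k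
  exists n<2^k with IsMinS-exists k<n
  ... | z , minimal with nVec-sum-complete 1<k k<n n<2^k minimal
  ...   | sum≡n , complete = let (e , independent) = independent-sequence _ (≤m sum≡n) in
    ≡.subst (λ N → Σ (Fin k → Fin N → Carrier) (IsFWSCode m)) sum≡n
            (segmentCode (nVec n k z) e , segmentCode-isFWS (nVec n k z) complete (≤m sum≡n) e independent)

  C-λ-n-isFWS : n < 2 ^ k → ∀ λ′ → Generates λ′ → ∀ z → IsMinS n k z →
                (sumVec (nVec n k z) ≡ n) × IsFWSCode m (blockGen λ′ (nVec n k z))
  C-λ-n-isFWS n<2^k λ′ generates z minimal with nVec-sum-complete 1<k k<n n<2^k minimal
  ... | sum≡n , complete =
    sum≡n , blockGen-isFWS (nVec n k z) complete (≤m sum≡n) λ′ (generator-powers-independent generates _ (≤m sum≡n))
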